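{- Let $p$ be an odd prime, let $G$ be a $p$-periodic graph on $n$ vertices, and let $\overline G$ be its quotient graph (which has $n/p$ vertices). Then $$U_G(x_1,\dots,x_n,y)\equiv U_{\overline G}(x_1,\dots,x_{n/p},y)$$ modulo the ideal of $\mathbb{Z}[x_1,\dots,x_n,y]$ generated by $p$, $y^p-y$, and the elements $x_k^p-x_k$ and $x_{pk}-x_k$ for all $k$ (for which these variables occur).
   Context: Here a graph $G$ is a finite graph with vertex set $V$ ($|V|=n$) and edge set $E$, possibly with multiple edges and loops. For $A\subseteq E$, $G|A$ denotes the spanning subgraph $(V,A)$, $k(G|A)$ its number of connected components, and $r(A)=n-k(G|A)$ its rank. With commuting indeterminates $x_1,\dots,x_n,y$, define $$U_G(x_1,\dots,x_n,y)=\sum_{A\subseteq E} x_{n_1}x_{n_2}\cdots x_{n_k}\,(y-1)^{|A|-r(A)},$$ where $n_1,\dots,n_k$ are the numbers of vertices of the connected components of $G|A$. For an integer $p\ge2$, $G$ is $p$-periodic if it has an automorphism $h$ (a permutation of vertices and edges preserving incidence) with $h^p=\mathrm{Id}$ and $h^i(v)\ne v$ for every vertex $v$ and every $1\le i\le p-1$. The quotient graph $\overline G$ has as vertices the orbits of $V$ under $\langle h\rangle$ and as edges the orbits of $E$ under $\langle h\rangle$, an edge orbit joining the vertex orbits containing the endpoints of its edges. -}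

module Defs where

open import Data.Nat as ℕ using (ℕ; zero; suc; _+_; _*_; _∸_; _<_; _≤ᵇ_; _<?_)
open import Data.Integer as ℤ using (ℤ)
open import Data.Fin as Fin using (Fin; toℕ; fromℕ<)
open import Data.Fin.Subset using (Subset; ⁅_⁆; ∣_∣; _∪_; inside; outside)
open import Data.Vec as Vec using (Vec; []; _∷_; lookup; tabulate)
open import Data.List as List using (List; []; _∷_; _++_; allFin; foldr; map; filter)
open import Data.Bool using (Bool; true; false; _∧_; _∨_; not; if_then_else_)
open import Data.Product using (_×_; _,_; proj₁; proj₂; Σ; ∃)
open import Data.Sum using (_⊎_)
open import Function using (_∘_)
open import Relation.Nullary using (yes; no)
open import Relation.Nullary.Decidable using (⌊_⌋)
open import Relation.Binary.PropositionalEquality using (_≡_; _≢_)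

-- Polynomial expressions over ℤ in the variables x_1,…,x_N and y.
-- var i stands for x_{toℕ i + 1}.

data Expr (N : ℕ) : Set where
  var   : Fin N → Expr N
  yv    : Expr N
  const : ℤ → Expr N
  _⊕_   : Expr N → Expr N → Expr N
  _⊗_   : Expr N → Expr N → Expr N
  ⊖_    : Expr N → Expr N

infixl 6 _⊕_ _⊝_
infixl 7 _⊗_

_⊝_ : ∀ {N} → Expr N → Expr N → Expr N
a ⊝ b = a ⊕ (⊖ b)

pow : ∀ {N} → Expr N → ℕ → Expr N
pow e zero    = const (ℤ.+ 1)
pow e (suc k) = e ⊗ pow e k

-- x_k for 1 ≤ k ≤ N; out-of-range indices (never used by U, since
-- component sizes lie in 1..number of vertices ≤ N) are sent to 0.
xv : (N k : ℕ) → Expr N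
xv N zero    = const (ℤ.+ 0)
xv N (suc j) with j <? N
... | yes j<N = var (fromℕ< j<N)
... | no  _   = const (ℤ.+ 0)

data Gen (p N : ℕ) : Expr N → Set where
  gen-p   : Gen p N (const (ℤ.+ p))
  gen-y   : Gen p N (pow yv p ⊝ yv)
  gen-x   : (i : Fin N) → Gen p N (pow (var i) p ⊝ var i)
  gen-xpk : (i j : Fin N) → suc (toℕ j) ≡ p * suc (toℕ i) →
            Gen p N (var j ⊝ var i)

-- The quotient Expr N / (≈ₚ) is exactly ℤ[x_1,…,x_N,y] / I_p.

data _≈[_]_ {N : ℕ} : Expr N → ℕ → Expr N → Set where
  ≈refl  : ∀ {p a} → a ≈[ p ] a
  ≈sym   : ∀ {p a b} → a ≈[ p ] b → b ≈[ p ] a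
  ≈trans : ∀ {p a b c} → a ≈[ p ] b → b ≈[ p ] c → a ≈[ p ] c
  ⊕-cong : ∀ {p a b c d} → a ≈[ p ] b → c ≈[ p ] d → (a ⊕ c) ≈[ p ] (b ⊕ d)
  ⊗-cong : ∀ {p a b c d} → a ≈[ p ] b → c ≈[ p ] d → (a ⊗ c) ≈[ p ] (b ⊗ d)
  ⊖-cong : ∀ {p a b} → a ≈[ p ] b → (⊖ a) ≈[ p ] (⊖ b)
  ⊕-assoc : ∀ {p a b c} → ((a ⊕ b) ⊕ c) ≈[ p ] (a ⊕ (b ⊕ c))
  ⊕-comm  : ∀ {p a b} → (a ⊕ b) ≈[ p ] (b ⊕ a)
  ⊕-idʳ   : ∀ {p a} → (a ⊕ const (ℤ.+ 0)) ≈[ p ] a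
  ⊖-invʳ  : ∀ {p a} → (a ⊕ (⊖ a)) ≈[ p ] const (ℤ.+ 0)
  ⊗-assoc : ∀ {p a b c} → ((a ⊗ b) ⊗ c) ≈[ p ] (a ⊗ (b ⊗ c))
  ⊗-comm  : ∀ {p a b} → (a ⊗ b) ≈[ p ] (b ⊗ a)
  ⊗-idʳ   : ∀ {p a} → (a ⊗ const (ℤ.+ 1)) ≈[ p ] a
  distrib : ∀ {p a b c} → (a ⊗ (b ⊕ c)) ≈[ p ] ((a ⊗ b) ⊕ (a ⊗ c))
  const-+ : ∀ {p m k} → (const m ⊕ const k) ≈[ p ] const (m ℤ.+ k)
  const-* : ∀ {p m k} → (const m ⊗ const k) ≈[ p ] const (m ℤ.* k)
  const-- : ∀ {p m} → (⊖ const m) ≈[ p ] const (ℤ.- m)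
  gen     : ∀ {p g} → Gen p N g → g ≈[ p ] const (ℤ.+ 0)

-- Finite multigraphs with loops: n vertices, m edges; each edge has an
-- (unordered) pair of end vertices, stored as an ordered pair.

record Graph (n m : ℕ) : Set where
  field ends : Fin m → Fin n × Fin n
open Graph public

mapPair : ∀ {n k} → (Fin n → Fin k) → Fin n × Fin n → Fin k × Fin k
mapPair f (a , b) = f a , f b

swap : ∀ {k} → Fin k × Fin k → Fin k × Fin k
swap (a , b) = b , a

_≡ᵤ_ : ∀ {k} → Fin k × Fin k → Fin k × Fin k → Set
x ≡ᵤ y = (x ≡ y) ⊎ (x ≡ swap y)

iter : ∀ {A : Set} → ℕ → (A → A) → A → A
iter zero    f a = a
iter (suc i) f a = f (iter i f a)

record IsPeriodicAut {n m : ℕ} (p : ℕ) (G : Graph n m)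
       (hv : Fin n → Fin n) (he : Fin m → Fin m) : Set where
  field
    incidence : ∀ e → ends G (he e) ≡ᵤ mapPair hv (ends G e)
    orderV    : ∀ v → iter p hv v ≡ v
    orderE    : ∀ e → iter p he e ≡ e
    free      : ∀ v i → 1 ℕ.≤ i → i < p → iter i hv v ≢ v

record IsQuotient {n m n' m' : ℕ} (G : Graph n m)
       (hv : Fin n → Fin n) (he : Fin m → Fin m) (Gb : Graph n' m')
       (πV : Fin n → Fin n') (πE : Fin m → Fin m') : Set where
  field
    surjV  : ∀ w → ∃ λ v → πV v ≡ w
    surjE  : ∀ f → ∃ λ e → πE e ≡ f
    orbitV : ∀ u v → (πV u ≡ πV v → ∃ λ i → iter i hv u ≡ v)
                   × ((∃ λ i → iter i hv u ≡ v) → πV u ≡ πV v)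
    orbitE : ∀ e f → (πE e ≡ πE f → ∃ λ i → iter i he e ≡ f)
                   × ((∃ λ i → iter i he e ≡ f) → πE e ≡ πE f)
    endsQ  : ∀ e → ends Gb (πE e) ≡ᵤ mapPair πV (ends G e)

_==_ : ∀ {k} → Fin k → Fin k → Bool
a == b = ⌊ a Fin.≟ b ⌋

anyL : ∀ {A : Set} → (A → Bool) → List A → Bool
anyL f = foldr (λ a r → f a ∨ r) false

allL : ∀ {A : Set} → (A → Bool) → List A → Bool
allL f = foldr (λ a r → f a ∧ r) true

countL : ∀ {A : Set} → (A → Bool) → List A → ℕ
countL f = foldr (λ a r → if f a then suc r else r) 0

step : ∀ {n m} → Graph n m → Subset m → Subset n → Subset n
step {n} {m} G A S = S ∪ tabulate λ v → anyL (λ e →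
    lookup A e ∧ ( (lookup S (proj₁ (ends G e)) ∧ (proj₂ (ends G e) == v))
                 ∨ (lookup S (proj₂ (ends G e)) ∧ (proj₁ (ends G e) == v)))) (allFin m)

-- vertex set of the connected component of v in G|A
-- (n closure steps suffice since paths have fewer than n edges)
comp : ∀ {n m} → Graph n m → Subset m → Fin n → Subset n
comp {n} G A v = iter n (step G A) ⁅ v ⁆

isRep : ∀ {n m} → Graph n m → Subset m → Fin n → Bool
isRep {n} G A v = allL (λ w → not (lookup (comp G A v) w) ∨ (toℕ v ≤ᵇ toℕ w)) (allFin n)

numComp : ∀ {n m} → Graph n m → Subset m → ℕ
numComp {n} G A = countL (isRep G A) (allFin n)

subsets : (m : ℕ) → List (Subset m)
subsets zero    = Vec.[] ∷ []
subsets (suc m) = map (outside Vec.∷_) (subsets m) ++ map (inside Vec.∷_) (subsets m)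

sumE : ∀ {N} → List (Expr N) → Expr N
sumE = foldr _⊕_ (const (ℤ.+ 0))

prodE : ∀ {N} → List (Expr N) → Expr N
prodE = foldr _⊗_ (const (ℤ.+ 1))

-- U_G(x_1,…,x_N,y) = Σ_{A⊆E} Π_{components C of G|A} x_{|C|} · (y−1)^{|A|−r(A)},
-- with r(A) = n − k(G|A), so |A| − r(A) = |A| + k(G|A) − n (≥ 0).
U : (N : ℕ) → ∀ {n m} → Graph n m → Expr N
U N {n} {m} G = sumE (map term (subsets m))
  where
  term : Subset m → Expr N
  term A = prodE (map (λ v → xv N ∣ comp G A v ∣) (filter (λ v → isRep G A v ≟b true) (allFin n)))
           ⊗ pow (yv ⊝ const (ℤ.+ 1)) ((∣ A ∣ + numComp G A) ∸ n)
    where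
    open import Data.Bool using () renaming (_≟_ to _≟b_)

module Submission where

-- The automorphism h acts on edge sets A ⊆ E, and the summand of A in U_G is constant on
-- orbits. An orbit of size p contributes a multiple of p, so modulo the ideal only the h-invariant
-- edge sets survive, and these are exactly the preimages A of the edge sets B of the quotient.
-- Over each component of Gb|B lies either one h-stable component of G|A, p times as large
-- (x_{pc} ≡ x_c), or p components of the same size (x_c^p ≡ x_c). With s stable and t unstable
-- components, |A| = p|B|, n = p n′, k(A) = s + p t and k(B) = s + t, so the nullities satisfy
-- e_A + (p − 1) s = p e_B; moreover e_A ≥ 1 when s ≥ 1, since the edges spanning a stable component
-- come in multiples of p and so must close a cycle. As (y − 1)^p ≡ y^p − 1 ≡ y − 1 for odd p, the
-- factors (y − 1)^{e_A} and (y − 1)^{e_B} agree modulo the ideal.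

open import Defs
open import Data.Nat using (ℕ; _≤_; _<_; _%_)
open import Data.Nat.Primality using (Prime)
open import Data.Fin using (Fin)
open import Data.Product using (∃)
open import Relation.Binary.Definitions using (DecidableEquality)
open import Relation.Binary.PropositionalEquality using (_≡_; _≢_)

module Arithmetic where

  open import Data.Nat
  open import Data.Nat.Properties
  open import Data.Nat.Combinatorics using (_C_; nCk≡n!/k![n-k]!; k![n∸k]!∣n!)
  open import Data.Nat.Coprimality using (prime⇒coprime; coprime-Bézout)
  open import Data.Nat.Divisibility using (_∣_; ∣⇒≤; m∣m*n)
  open import Data.Nat.DivMod using (_%_; m/n*n≡m; [m+kn]%n≡m%n; m<n⇒m%n≡m)
  open import Data.Nat.GCD using (module Bézout)
  open import Data.Nat.Primality using (Prime; prime⇒nonZero; prime⇒nonTrivial; euclidsLemma)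
  open import Data.Nat.Tactic.RingSolver using (solve-∀)
  open import Data.Sum using (inj₁; inj₂)
  open import Data.Empty using (⊥-elim)
  open import Relation.Nullary using (¬_; yes; no)
  open import Relation.Binary.PropositionalEquality

  prime>1 : ∀ {p} → Prime p → 1 < p
  prime>1 {p} pr = nonTrivial⇒n>1 p {{prime⇒nonTrivial pr}}

  n∣n! : ∀ n → .{{NonZero n}} → n ∣ n !
  n∣n! (suc n) = m∣m*n (n !)

  prime∤! : ∀ {p} → Prime p → ∀ k → k < p → ¬ p ∣ k !
  prime∤! pr zero    _   p∣1 = <⇒≱ (prime>1 pr) (∣⇒≤ p∣1)
  prime∤! pr (suc k) k<p p∣k! with euclidsLemma (suc k) (k !) pr p∣k!
  ... | inj₁ p∣k+1 = <⇒≱ k<p (∣⇒≤ p∣k+1)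
  ... | inj₂ p∣k!  = prime∤! pr k (<-trans (n<1+n k) k<p) p∣k!

  prime∣pCk : ∀ {p k} → Prime p → 0 < k → k < p → p ∣ p C k
  prime∣pCk {p} {k} pr 0<k k<p
    with euclidsLemma (p C k) (k ! * (p ∸ k) !) pr (subst (p ∣_) (sym pCk*k!*[p-k]!≡p!) (n∣n! p {{prime⇒nonZero pr}}))
    where
    instance _ = k !* (p ∸ k) !≢0
    pCk*k!*[p-k]!≡p! : (p C k) * (k ! * (p ∸ k) !) ≡ p !
    pCk*k!*[p-k]!≡p! = trans (cong (_* (k ! * (p ∸ k) !)) (nCk≡n!/k![n-k]! (<⇒≤ k<p)))
                             (m/n*n≡m (k![n∸k]!∣n! (<⇒≤ k<p)))
  ... | inj₁ p∣pCk = p∣pCk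
  ... | inj₂ p∣k!*[p-k]! with euclidsLemma (k !) ((p ∸ k) !) pr p∣k!*[p-k]!
  ...   | inj₁ p∣k!      = ⊥-elim (prime∤! pr k k<p p∣k!)
  ...   | inj₂ p∣[p-k]!  = ⊥-elim (prime∤! pr (p ∸ k) (∸-monoʳ-< 0<k (<⇒≤ k<p)) p∣[p-k]!)

  module _ (Q : ℕ → Set) (Q0 : Q 0) (Q+ : ∀ {a b} → Q a → Q b → Q (a + b)) where

    private
      multiples : ∀ {d} → Q d → ∀ k → Q (k * d)
      multiples Qd zero    = Q0
      multiples Qd (suc k) = Q+ Qd (multiples Qd k)

    -- Bézout for the coprime pair (p , d) provides a multiple of d that is 1 modulo p.
    closed-under-+-and-%⇒1 : ∀ {p} (pr : Prime p) → (∀ {a} → Q a → Q ((a % p) {{prime⇒nonZero pr}})) →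
                             ∀ {d} → 0 < d → d < p → Q d → Q 1
    closed-under-+-and-%⇒1 {suc q} pr Q% {d@(suc _)} _ d<p Qd with coprime-Bézout (prime⇒coprime pr d<p)
    ... | Bézout.-+ x y 1+x[1+q]≡yd = subst Q (begin
      (y * d) % suc q              ≡⟨ cong (_% suc q) 1+x[1+q]≡yd ⟨
      (1 + x * suc q) % suc q      ≡⟨ [m+kn]%n≡m%n 1 x (suc q) ⟩
      1 % suc q                    ≡⟨ m<n⇒m%n≡m (prime>1 pr) ⟩
      1                            ∎) (Q% (multiples Qd y))
      where open ≡-Reasoning
    ... | Bézout.+- x y 1+yd≡x[1+q] = subst Q (begin
      (y * q * d) % suc q                  ≡⟨ [m+kn]%n≡m%n (y * q * d) 1 (suc q) ⟨
      (y * q * d + 1 * suc q) % suc q      ≡⟨ cong (_% suc q) (rearrange q y d) ⟩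
      (1 + q * (1 + y * d)) % suc q        ≡⟨ cong (λ z → (1 + q * z) % suc q) 1+yd≡x[1+q] ⟩
      (1 + q * (x * suc q)) % suc q        ≡⟨ cong (λ z → (1 + z) % suc q) (*-assoc q x (suc q)) ⟨
      (1 + q * x * suc q) % suc q          ≡⟨ [m+kn]%n≡m%n 1 (q * x) (suc q) ⟩
      1 % suc q                            ≡⟨ m<n⇒m%n≡m (prime>1 pr) ⟩
      1                                    ∎) (Q% (multiples Qd (y * q)))
      where
      open ≡-Reasoning
      rearrange : ∀ q y d → y * q * d + 1 * suc q ≡ 1 + q * (1 + y * d)
      rearrange = solve-∀

  m*n≤m*o+1⇒n≤o : ∀ {m n o} → 1 < m → m * n ≤ m * o + 1 → n ≤ o
  m*n≤m*o+1⇒n≤o {m} {n} {o} 1<m mn≤mo+1 with n ≤? o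
  ... | yes n≤o = n≤o
  ... | no  n≰o = ⊥-elim (<⇒≱ 1<m (+-cancelʳ-≤ (m * o) m 1 m+mo≤1+mo))
    where
    m+mo≤1+mo : m + m * o ≤ 1 + m * o
    m+mo≤1+mo = begin
      m + m * o   ≡⟨ *-suc m o ⟨
      m * suc o   ≤⟨ *-monoʳ-≤ m (≰⇒> n≰o) ⟩
      m * n       ≤⟨ mn≤mo+1 ⟩
      m * o + 1   ≡⟨ +-comm (m * o) 1 ⟩
      1 + m * o   ∎
      where open ≤-Reasoning

  ∸-+-*-shift : ∀ m b s t k → .{{NonZero m}} → k ≤ b + (s + t) → m * k ≤ m * b + (s + m * t) →
                (m * b + (s + m * t)) ∸ m * k + (m ∸ 1) * s ≡ m * ((b + (s + t)) ∸ k)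
  ∸-+-*-shift m@(suc q) b s t k k≤W mk≤Z = +-cancelʳ-≡ (m * k) _ _ (begin
    (Z ∸ m * k) + q * s + m * k   ≡⟨ swap-last (Z ∸ m * k) (q * s) (m * k) ⟩
    (Z ∸ m * k) + m * k + q * s   ≡⟨ cong (_+ q * s) (m∸n+n≡m mk≤Z) ⟩
    Z + q * s                     ≡⟨ collect q b s t ⟩
    m * W                         ≡⟨ cong (m *_) (m∸n+n≡m k≤W) ⟨
    m * ((W ∸ k) + k)             ≡⟨ *-distribˡ-+ m (W ∸ k) k ⟩
    m * (W ∸ k) + m * k           ∎)
    where
    open ≡-Reasoning
    Z = m * b + (s + m * t)
    W = b + (s + t)
    swap-last : ∀ a x y → a + x + y ≡ a + y + x
    swap-last = solve-∀
    collect : ∀ q b s t → suc q * b + (s + suc q * t) + q * s ≡ suc q * (b + (s + t))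
    collect = solve-∀

module Iteration where

  open import Data.Nat
  open import Data.Nat.Properties
  open import Data.Nat.DivMod using (_%_; _/_; m≡m%n+[m/n]*n; m%n<n)
  open import Data.Nat.Primality using (Prime)
  open import Data.List using (List; applyUpTo; length)
  open import Data.List.Properties using (length-applyUpTo)
  open import Data.List.Membership.Propositional using (_∈_)
  open import Data.List.Membership.Propositional.Properties using (∈-applyUpTo⁺; ∈-applyUpTo⁻)
  open import Data.List.Relation.Unary.Unique.Propositional using (Unique)
  open import Data.List.Relation.Unary.Unique.Propositional.Properties using (applyUpTo⁺₁)
  open import Data.Product using (∃; _×_)
  open import Relation.Binary.PropositionalEquality
  open Arithmetic using (closed-under-+-and-%⇒1)

  module _ {A : Set} (f : A → A) where

    iter-+ : ∀ a b x → iter (a + b) f x ≡ iter a f (iter b f x)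
    iter-+ zero    b x = refl
    iter-+ (suc a) b x = cong f (iter-+ a b x)

    iter-comm : ∀ a x → iter a f (f x) ≡ f (iter a f x)
    iter-comm a x = trans (sym (iter-+ a 1 x)) (cong (λ k → iter k f x) (+-comm a 1))

    iter-fixed : ∀ {x} → f x ≡ x → ∀ k → iter k f x ≡ x
    iter-fixed fx≡x zero    = refl
    iter-fixed fx≡x (suc k) = trans (cong f (iter-fixed fx≡x k)) fx≡x

  module Periodic {X : Set} (σ : X → X) (p : ℕ) .{{_ : NonZero p}} (σ^p≡id : ∀ x → iter p σ x ≡ x) where

    iter-*p : ∀ k x → iter (k * p) σ x ≡ x
    iter-*p zero    x = refl
    iter-*p (suc k) x = trans (iter-+ σ p (k * p) x) (trans (cong (iter p σ) (iter-*p k x)) (σ^p≡id x))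

    iter-% : ∀ a x → iter (a % p) σ x ≡ iter a σ x
    iter-% a x = sym (begin
      iter a σ x                               ≡⟨ cong (λ k → iter k σ x) (m≡m%n+[m/n]*n a p) ⟩
      iter (a % p + a / p * p) σ x             ≡⟨ iter-+ σ (a % p) (a / p * p) x ⟩
      iter (a % p) σ (iter (a / p * p) σ x)    ≡⟨ cong (iter (a % p) σ) (iter-*p (a / p) x) ⟩
      iter (a % p) σ x                         ∎)
      where open ≡-Reasoning

    private
      p≡1+[p∸1] : p ≡ suc (p ∸ 1)
      p≡1+[p∸1] = sym (m+[n∸m]≡n {1} (>-nonZero⁻¹ p))

    σ⁻¹ : X → X
    σ⁻¹ = iter (p ∸ 1) σ

    σ⁻¹∘σ : ∀ x → σ⁻¹ (σ x) ≡ x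
    σ⁻¹∘σ x = trans (iter-comm σ (p ∸ 1) x) (trans (cong (λ k → iter k σ x) (sym p≡1+[p∸1])) (σ^p≡id x))

    σ∘σ⁻¹ : ∀ x → σ (σ⁻¹ x) ≡ x
    σ∘σ⁻¹ x = trans (cong (λ k → iter k σ x) (sym p≡1+[p∸1])) (σ^p≡id x)

    σ-injective : ∀ {x y} → σ x ≡ σ y → x ≡ y
    σ-injective {x} {y} e = trans (sym (σ⁻¹∘σ x)) (trans (cong σ⁻¹ e) (σ⁻¹∘σ y))

    iter-injective : ∀ a {x y} → iter a σ x ≡ iter a σ y → x ≡ y
    iter-injective zero    e = e
    iter-injective (suc a) e = iter-injective a (σ-injective e)

    orbit : X → List X
    orbit x = applyUpTo (λ i → iter i σ x) p

    length-orbit : ∀ x → length (orbit x) ≡ p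
    length-orbit x = length-applyUpTo _ p

    ∈-orbit⁺ : ∀ x a → iter a σ x ∈ orbit x
    ∈-orbit⁺ x a = subst (_∈ orbit x) (iter-% a x) (∈-applyUpTo⁺ (λ i → iter i σ x) (m%n<n a p))

    ∈-orbit⁻ : ∀ x {y} → y ∈ orbit x → ∃ λ i → i < p × y ≡ iter i σ x
    ∈-orbit⁻ x = ∈-applyUpTo⁻ (λ i → iter i σ x)

    orbit-unique : ∀ x → (∀ d → 0 < d → d < p → iter d σ x ≢ x) → Unique (orbit x)
    orbit-unique x free = applyUpTo⁺₁ _ p λ {i} {j} i<j j<p σⁱx≡σʲx →
      free (j ∸ i) (m<n⇒0<n∸m i<j) (≤-<-trans (m∸n≤m j i) j<p)
        (sym (iter-injective i (begin
          iter i σ x                     ≡⟨ σⁱx≡σʲx ⟩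
          iter j σ x                     ≡⟨ cong (λ k → iter k σ x) (m+[n∸m]≡n (<⇒≤ i<j)) ⟨
          iter (i + (j ∸ i)) σ x         ≡⟨ iter-+ σ i (j ∸ i) x ⟩
          iter i σ (iter (j ∸ i) σ x)    ∎)))
      where open ≡-Reasoning

    module _ (pr : Prime p) (R : X → X → Set) (R-refl : ∀ {x} → R x x)
             (R-trans : ∀ {x y z} → R x y → R y z → R x z)
             (R-σ : ∀ {x y} → R x y → R (σ x) (σ y)) where

      private
        R-iter : ∀ a {x y} → R x y → R (iter a σ x) (iter a σ y)
        R-iter zero    r = r
        R-iter (suc a) r = R-σ (R-iter a r)

      related-to-iterate⇒related-to-σ : ∀ {x d} → 0 < d → d < p → R x (iter d σ x) → R x (σ x)
      related-to-iterate⇒related-to-σ {x} = closed-under-+-and-%⇒1 (λ a → R x (iter a σ x)) R-refl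
        (λ {a} {b} r-a r-b → subst (R x) (sym (iter-+ σ a b x)) (R-trans r-a (R-iter a r-b)))
        pr (λ {a} r-a → subst (R x) (sym (iter-% a x)) r-a)

module Lists where

  open import Data.Nat using (suc; _+_; _*_; _≤_; z≤n; s≤s)
  open import Data.Nat.Properties using (+-suc; m≤n⇒m≤1+n; *-zeroʳ; *-suc)
  open import Data.Bool as Bool using (Bool; true; false; not)
  open import Data.List using (List; []; _∷_; _++_; map; concatMap; filter; length)
  open import Data.List.Properties using (length-++)
  open import Data.List.Membership.Propositional using (_∈_; find)
  open import Data.List.Membership.Propositional.Properties using (∈-concatMap⁻)
  open import Data.List.Membership.Propositional.Properties.WithK using (unique∧set⇒bag)
  open import Data.List.Relation.Unary.Any using (here; there)
  import Data.List.Relation.Unary.All as All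
  import Data.List.Relation.Unary.All.Properties as All
  open import Data.List.Relation.Unary.Unique.Propositional using (Unique; []; _∷_)
  import Data.List.Relation.Unary.Unique.Propositional.Properties as Unique
  open import Data.List.Relation.Binary.Permutation.Propositional using (_↭_)
  open import Data.List.Relation.Binary.BagAndSetEquality using (∼bag⇒↭)
  open import Data.Product using (∃; _×_; _,_; proj₁; proj₂)
  open import Data.Sum using (_⊎_; inj₁; inj₂)
  open import Data.Empty using (⊥-elim)
  open import Function using (_∘_)
  open import Function.Bundles using (mk⇔)
  open import Relation.Nullary using (¬_)
  open import Relation.Binary.PropositionalEquality

  ≡true⇒≢false : ∀ {b} → b ≡ true → b ≢ false
  ≡true⇒≢false refl ()

  ∧≡true : ∀ {a b} → a Bool.∧ b ≡ true → a ≡ true × b ≡ true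
  ∧≡true {true} {true} refl = refl , refl

  ∨≡true : ∀ {a b} → a Bool.∨ b ≡ true → a ≡ true ⊎ b ≡ true
  ∨≡true {true}  _    = inj₁ refl
  ∨≡true {false} b≡t = inj₂ b≡t

  ≡true⇒∨ˡ : ∀ {a} b → a ≡ true → a Bool.∨ b ≡ true
  ≡true⇒∨ˡ b refl = refl

  ≡true⇒∨ʳ : ∀ a {b} → b ≡ true → a Bool.∨ b ≡ true
  ≡true⇒∨ʳ true  _    = refl
  ≡true⇒∨ʳ false b≡t = b≡t

  true⇔true⇒≡ : ∀ {a b} → (a ≡ true → b ≡ true) → (b ≡ true → a ≡ true) → a ≡ b
  true⇔true⇒≡ {true}  a⇒b _   = sym (a⇒b refl)
  true⇔true⇒≡ {false} {true}  _ b⇒a = b⇒a refl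
  true⇔true⇒≡ {false} {false} _ _   = refl

  module _ {A : Set} where

    unique∧same-members⇒↭ : ∀ {xs ys : List A} → Unique xs → Unique ys →
                             (∀ {x} → x ∈ xs → x ∈ ys) → (∀ {x} → x ∈ ys → x ∈ xs) → xs ↭ ys
    unique∧same-members⇒↭ !xs !ys xs⊆ys ys⊆xs = ∼bag⇒↭ (unique∧set⇒bag !xs !ys (mk⇔ xs⊆ys ys⊆xs))

    module _ {B : Set} (f : A → B) where

      map⁺-injectiveOn : ∀ {xs} → Unique xs → (∀ {a b} → a ∈ xs → b ∈ xs → f a ≡ f b → a ≡ b) →
                         Unique (map f xs)
      map⁺-injectiveOn {[]}     []          _   = []
      map⁺-injectiveOn {x ∷ xs} (x∉xs ∷ !xs) inj =
        All.map⁺ (All.tabulate fx∉) ∷ map⁺-injectiveOn !xs (λ a b → inj (there a) (there b))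
        where
        fx∉ : ∀ {y} → y ∈ xs → f x ≢ f y
        fx∉ y∈xs fx≡fy = All.lookup x∉xs y∈xs (inj (here refl) (there y∈xs) fx≡fy)

    concatMap⁺ : ∀ {B : Set} (f : A → List B) (g : B → A) {xs} → Unique xs → (∀ x → Unique (f x)) →
                 (∀ x {y} → y ∈ f x → g y ≡ x) → Unique (concatMap f xs)
    concatMap⁺ f g {[]}     _            _  _   = []
    concatMap⁺ f g {x ∷ xs} (x∉xs ∷ !xs) !f g∘f = Unique.++⁺ (!f x) (concatMap⁺ f g !xs !f g∘f) disjoint
      where
      disjoint : ∀ {v} → ¬ (v ∈ f x × v ∈ concatMap f xs)
      disjoint (v∈fx , v∈rest) with find (∈-concatMap⁻ f {xs = xs} v∈rest)
      ... | x′ , x′∈xs , v∈fx′ = All.lookup x∉xs x′∈xs (trans (sym (g∘f x v∈fx)) (g∘f x′ v∈fx′))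

    length-concatMap-const : ∀ {B : Set} (f : A → List B) {c} xs → (∀ x → length (f x) ≡ c) →
                             length (concatMap f xs) ≡ c * length xs
    length-concatMap-const f {c} []       _       = sym (*-zeroʳ c)
    length-concatMap-const f {c} (x ∷ xs) len-f≡c = begin
      length (f x ++ concatMap f xs)             ≡⟨ length-++ (f x) ⟩
      length (f x) + length (concatMap f xs)     ≡⟨ cong₂ _+_ (len-f≡c x) (length-concatMap-const f xs len-f≡c) ⟩
      c + c * length xs                          ≡⟨ *-suc c (length xs) ⟨
      c * suc (length xs)                        ∎
      where open ≡-Reasoning

    module _ (f : A → Bool) where

      countL≡length-filter : ∀ xs → countL f xs ≡ length (filter (λ x → f x Bool.≟ true) xs)
      countL≡length-filter []       = refl
      countL≡length-filter (x ∷ xs) with f x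
      ... | true  = cong suc (countL≡length-filter xs)
      ... | false = countL≡length-filter xs

      countL+countL-not≡length : ∀ xs → countL f xs + countL (not ∘ f) xs ≡ length xs
      countL+countL-not≡length []       = refl
      countL+countL-not≡length (x ∷ xs) with f x
      ... | true  = cong suc (countL+countL-not≡length xs)
      ... | false = trans (+-suc _ _) (cong suc (countL+countL-not≡length xs))

      countL≢0⇒∃ : ∀ xs → 1 ≤ countL f xs → ∃ λ x → x ∈ xs × f x ≡ true
      countL≢0⇒∃ (x ∷ xs) 1≤count with f x in fx≡
      ... | true  = x , here refl , fx≡
      ... | false with countL≢0⇒∃ xs 1≤count
      ...   | y , y∈xs , fy≡ = y , there y∈xs , fy≡

  module _ {A : Set} (f : A → Bool) where

    anyL≡true⁻ : ∀ xs → anyL f xs ≡ true → ∃ λ x → x ∈ xs × f x ≡ true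
    anyL≡true⁻ (x ∷ xs) any≡t with ∨≡true {f x} any≡t
    ... | inj₁ fx≡t = x , here refl , fx≡t
    ... | inj₂ rest≡t with anyL≡true⁻ xs rest≡t
    ...   | y , y∈ , fy≡t = y , there y∈ , fy≡t

    anyL≡true⁺ : ∀ {xs x} → x ∈ xs → f x ≡ true → anyL f xs ≡ true
    anyL≡true⁺ {x ∷ xs} (here refl) fx≡t = ≡true⇒∨ˡ _ fx≡t
    anyL≡true⁺ {y ∷ xs} (there x∈) fx≡t = ≡true⇒∨ʳ (f y) (anyL≡true⁺ x∈ fx≡t)

    allL≡true⁻ : ∀ xs → allL f xs ≡ true → ∀ {x} → x ∈ xs → f x ≡ true
    allL≡true⁻ (y ∷ xs) all≡t (here refl) = proj₁ (∧≡true all≡t)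
    allL≡true⁻ (y ∷ xs) all≡t (there x∈) = allL≡true⁻ xs (proj₂ (∧≡true {f y} all≡t)) x∈

    allL≡true⁺ : ∀ xs → (∀ {x} → x ∈ xs → f x ≡ true) → allL f xs ≡ true
    allL≡true⁺ []       _    = refl
    allL≡true⁺ (y ∷ xs) f≡t rewrite f≡t (here refl) = allL≡true⁺ xs (f≡t ∘ there)

  module _ {A : Set} (f g : A → Bool) where

    countL-mono : ∀ xs → (∀ {x} → x ∈ xs → f x ≡ true → g x ≡ true) → countL f xs ≤ countL g xs
    countL-mono []       _   = z≤n
    countL-mono (x ∷ xs) f⇒g with f x in fx | g x in gx
    ... | true  | true  = s≤s (countL-mono xs (f⇒g ∘ there))
    ... | true  | false with () ← trans (sym gx) (f⇒g (here refl) fx)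
    ... | false | true  = m≤n⇒m≤1+n (countL-mono xs (f⇒g ∘ there))
    ... | false | false = countL-mono xs (f⇒g ∘ there)

    countL≤1+countL : ∀ xs → Unique xs → (∀ {x} → g x ≡ true → f x ≡ true) →
                      (∀ {x y} → x ∈ xs → y ∈ xs → f x ≡ true → g x ≡ false → f y ≡ true → g y ≡ false → x ≡ y) →
                      countL f xs ≤ suc (countL g xs)
    countL≤1+countL []       _              _   _       = z≤n
    countL≤1+countL (x ∷ xs) (x∉xs ∷ !xs)  g⇒f at-most-one with f x in fx | g x in gx
    ... | true  | true  = s≤s (countL≤1+countL xs !xs g⇒f λ x∈ y∈ → at-most-one (there x∈) (there y∈))
    ... | true  | false = s≤s (countL-mono xs f⇒g)
      where
      f⇒g : ∀ {y} → y ∈ xs → f y ≡ true → g y ≡ true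
      f⇒g {y} y∈ fy with g y in gy
      ... | true  = refl
      ... | false = ⊥-elim (All.lookup x∉xs y∈ (at-most-one (here refl) (there y∈) fx gx fy gy))
    ... | false | true  with () ← trans (sym fx) (g⇒f gx)
    ... | false | false = countL≤1+countL xs !xs g⇒f λ x∈ y∈ → at-most-one (there x∈) (there y∈)

module Subsets where

  open import Data.Nat using (ℕ; zero; suc)
  open import Data.Bool using (Bool; true; false)
  import Data.Bool as Bool
  open import Data.Fin using (Fin)
  import Data.Fin as Fin
  open import Data.Fin.Subset as Subset using (Subset; ∣_∣)
  import Data.Fin.Subset.Properties as Subset
  open import Data.Vec as Vec using (_∷_; []; lookup)
  import Data.Vec.Properties as Vec
  open import Data.List using (List; []; _∷_; _++_; map; length)
  open import Data.Fin.Properties using (suc-injective)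
  open import Data.List.Properties using (length-map)
  open import Data.List.Membership.Propositional using (_∈_; _∉_)
  open import Data.List.Membership.Propositional.Properties using (∈-map⁺; ∈-map⁻; ∈-++⁺ˡ; ∈-++⁺ʳ)
  open import Data.List.Relation.Unary.Any using (here; there)
  open import Data.List.Relation.Unary.All using (All; []; _∷_)
  import Data.List.Relation.Unary.All as All
  import Data.List.Relation.Unary.All.Properties as All
  open import Data.List.Relation.Unary.Unique.Propositional using (Unique; []; _∷_)
  import Data.List.Relation.Unary.Unique.Propositional.Properties as Unique
  open import Data.List.Relation.Binary.Permutation.Propositional using (_↭_)
  open import Data.List.Relation.Binary.Permutation.Propositional.Properties using (↭-length)
  open import Data.Product using (∃; _×_; _,_)
  open import Data.Sum using (inj₁; inj₂)
  open import Function using (_∘_)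
  open import Data.Empty using (⊥-elim)
  open import Relation.Nullary using (¬_)
  open import Relation.Binary.PropositionalEquality
  open Lists

  ⊆∧≢⇒⊂ : ∀ {k} {S T : Subset k} → S Subset.⊆ T → T ≢ S → S Subset.⊂ T
  ⊆∧≢⇒⊂ {S = []}        {[]}        _   T≢S = ⊥-elim (T≢S refl)
  ⊆∧≢⇒⊂ {S = true ∷ S}  {false ∷ T} S⊆T _   with S⊆T Vec.here
  ... | ()
  ⊆∧≢⇒⊂ {S = false ∷ S} {true ∷ T}  S⊆T _   = S⊆T , Fin.zero , Vec.here , λ ()
  ⊆∧≢⇒⊂ {S = true ∷ S}  {true ∷ T}  S⊆T T≢S = Subset.s⊂s (⊆∧≢⇒⊂ (Subset.drop-∷-⊆ S⊆T) (T≢S ∘ cong (true ∷_)))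
  ⊆∧≢⇒⊂ {S = false ∷ S} {false ∷ T} S⊆T T≢S = Subset.s⊂s (⊆∧≢⇒⊂ (Subset.drop-∷-⊆ S⊆T) (T≢S ∘ cong (false ∷_)))

  lookup-ext : ∀ {A : Set} {k} {u v : Vec.Vec A k} → (∀ i → lookup u i ≡ lookup v i) → u ≡ v
  lookup-ext {u = u} {v} eq = trans (sym (Vec.tabulate∘lookup u)) (trans (Vec.tabulate-cong eq) (Vec.tabulate∘lookup v))

  lookup-⊆ : ∀ {k} {S T : Subset k} → (∀ {x} → lookup S x ≡ true → lookup T x ≡ true) → S Subset.⊆ T
  lookup-⊆ S⊆T {x} x∈S = Vec.lookup⇒[]= x _ (S⊆T (Vec.[]=⇒lookup x∈S))

  elements : ∀ {k} → Subset k → List (Fin k)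
  elements []          = []
  elements (true ∷ S)  = Fin.zero ∷ map Fin.suc (elements S)
  elements (false ∷ S) = map Fin.suc (elements S)

  ∣∣≡length-elements : ∀ {k} (S : Subset k) → ∣ S ∣ ≡ length (elements S)
  ∣∣≡length-elements []          = refl
  ∣∣≡length-elements (true ∷ S)  = cong suc (trans (∣∣≡length-elements S) (sym (length-map Fin.suc (elements S))))
  ∣∣≡length-elements (false ∷ S) = trans (∣∣≡length-elements S) (sym (length-map Fin.suc (elements S)))

  ∈-elements⁺ : ∀ {k} (S : Subset k) {x} → lookup S x ≡ true → x ∈ elements S
  ∈-elements⁺ (true ∷ S)  {Fin.zero}  _     = here refl
  ∈-elements⁺ (true ∷ S)  {Fin.suc x} x∈S   = there (∈-map⁺ Fin.suc (∈-elements⁺ S x∈S))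
  ∈-elements⁺ (false ∷ S) {Fin.suc x} x∈S   = ∈-map⁺ Fin.suc (∈-elements⁺ S x∈S)

  ∈-elements⁻ : ∀ {k} (S : Subset k) {x} → x ∈ elements S → lookup S x ≡ true
  ∈-elements⁻ (true ∷ S)  (here refl) = refl
  ∈-elements⁻ (true ∷ S)  (there x∈)  with ∈-map⁻ Fin.suc x∈
  ... | _ , y∈ , refl = ∈-elements⁻ S y∈
  ∈-elements⁻ (false ∷ S) x∈          with ∈-map⁻ Fin.suc x∈
  ... | _ , y∈ , refl = ∈-elements⁻ S y∈

  elements-unique : ∀ {k} (S : Subset k) → Unique (elements S)
  elements-unique []          = []
  elements-unique (true ∷ S)  = All.tabulate zero∉ ∷ Unique.map⁺ suc-injective (elements-unique S)
    where
    zero∉ : ∀ {y} → y ∈ map Fin.suc (elements S) → Fin.zero ≢ y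
    zero∉ y∈ with ∈-map⁻ Fin.suc y∈
    ... | _ , _ , refl = λ ()
  elements-unique (false ∷ S) = Unique.map⁺ suc-injective (elements-unique S)

  ∣∣-bijection : ∀ {k l} (S : Subset k) (T : Subset l) (f : Fin k → Fin l) →
                 (∀ {x y} → lookup S x ≡ true → lookup S y ≡ true → f x ≡ f y → x ≡ y) →
                 (∀ {x} → lookup S x ≡ true → lookup T (f x) ≡ true) →
                 (∀ {y} → lookup T y ≡ true → ∃ λ x → lookup S x ≡ true × f x ≡ y) →
                 ∣ S ∣ ≡ ∣ T ∣
  ∣∣-bijection S T f inj into onto = begin
    ∣ S ∣                      ≡⟨ ∣∣≡length-elements S ⟩
    length (elements S)        ≡⟨ length-map f (elements S) ⟨
    length (map f (elements S)) ≡⟨ ↭-length f[S]↭T ⟩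
    length (elements T)        ≡⟨ ∣∣≡length-elements T ⟨
    ∣ T ∣                      ∎
    where
    open ≡-Reasoning
    f[S]↭T : map f (elements S) ↭ elements T
    f[S]↭T = unique∧same-members⇒↭
      (map⁺-injectiveOn f (elements-unique S) (λ x∈ y∈ → inj (∈-elements⁻ S x∈) (∈-elements⁻ S y∈)))
      (elements-unique T)
      (λ y∈ → let x , x∈ , y≡fx = ∈-map⁻ f y∈ in subst (_∈ elements T) (sym y≡fx) (∈-elements⁺ T (into (∈-elements⁻ S x∈))))
      (λ y∈ → let x , x∈S , fx≡y = onto (∈-elements⁻ T y∈) in subst (_∈ map f (elements S)) fx≡y (∈-map⁺ f (∈-elements⁺ S x∈S)))

  ∣[]≔true∣ : ∀ {k} (S : Subset k) x → lookup S x ≡ false → ∣ S Vec.[ x ]≔ true ∣ ≡ suc ∣ S ∣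
  ∣[]≔true∣ (false ∷ S) Fin.zero    _     = refl
  ∣[]≔true∣ (true ∷ S)  (Fin.suc x) x∉S  = cong suc (∣[]≔true∣ S x x∉S)
  ∣[]≔true∣ (false ∷ S) (Fin.suc x) x∉S  = ∣[]≔true∣ S x x∉S

  subsets-unique : ∀ k → Unique (subsets k)
  subsets-unique zero    = [] ∷ []
  subsets-unique (suc k) = Unique.++⁺ (Unique.map⁺ Vec.∷-injectiveʳ (subsets-unique k))
                                      (Unique.map⁺ Vec.∷-injectiveʳ (subsets-unique k)) disjoint
    where
    disjoint : ∀ {S} → ¬ (S ∈ map (false Vec.∷_) (subsets k) × S ∈ map (true Vec.∷_) (subsets k))
    disjoint (S∈₁ , S∈₂) with ∈-map⁻ (false Vec.∷_) S∈₁ | ∈-map⁻ (true Vec.∷_) S∈₂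
    ... | _ , _ , refl | _ , _ , ()

  ∈-subsets : ∀ {k} (S : Subset k) → S ∈ subsets k
  ∈-subsets []          = here refl
  ∈-subsets (false ∷ S) = ∈-++⁺ˡ (∈-map⁺ (false Vec.∷_) (∈-subsets S))
  ∈-subsets (true ∷ S)  = ∈-++⁺ʳ (map (false Vec.∷_) (subsets _)) (∈-map⁺ (true Vec.∷_) (∈-subsets S))

  module _ {k : ℕ} where

    ≡ᵤ-sym : {x y : Fin k × Fin k} → x ≡ᵤ y → y ≡ᵤ x
    ≡ᵤ-sym (inj₁ refl) = inj₁ refl
    ≡ᵤ-sym (inj₂ refl) = inj₂ refl

    ≡ᵤ-trans : {x y z : Fin k × Fin k} → x ≡ᵤ y → y ≡ᵤ z → x ≡ᵤ z
    ≡ᵤ-trans (inj₁ refl) y≡z         = y≡z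
    ≡ᵤ-trans (inj₂ refl) (inj₁ refl) = inj₂ refl
    ≡ᵤ-trans (inj₂ refl) (inj₂ refl) = inj₁ refl

    ≡ᵤ-mapPair : ∀ {j} (f : Fin k → Fin j) {x y} → x ≡ᵤ y → mapPair f x ≡ᵤ mapPair f y
    ≡ᵤ-mapPair f (inj₁ refl) = inj₁ refl
    ≡ᵤ-mapPair f (inj₂ refl) = inj₂ refl

module QuotientRing (p N : ℕ) where

  open import Data.Nat as ℕ using (zero; suc; _≤_; _<_; z≤n; s≤s)
  import Data.Nat.Properties as ℕ
  open import Data.Nat.Divisibility using (_∣_; divides)
  open import Data.Nat.DivMod using (_%_; _/_; m≡m%n+[m/n]*n)
  open import Data.Nat.Combinatorics using (_C_; nCn≡1)
  open import Data.Nat.Primality using (Prime; prime⇒nonZero)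
  open import Data.Integer using (+_)
  open import Data.Fin as Fin using (Fin; toℕ; fromℕ; fromℕ<; inject₁)
  open import Data.Fin.Properties using (toℕ-fromℕ; toℕ-inject₁; toℕ<n; toℕ-fromℕ<)
  open import Data.List using (List; []; _∷_; _++_; map; concatMap; length)
  open import Data.List.Properties using (map-++)
  open import Data.List.Membership.Propositional using (_∈_)
  open import Data.List.Relation.Unary.Any using (here; there)
  open import Data.List.Relation.Binary.Permutation.Propositional using (_↭_; ↭⇒↭ₛ′)
  open import Data.List.Relation.Binary.Permutation.Setoid.Properties using (foldr-commMonoid)
  open import Data.Product using (_,_)
  open import Data.Empty using (⊥-elim)
  open import Function using (_∘_)
  open import Level using (0ℓ)
  open import Algebra.Bundles using (CommutativeRing)
  open import Algebra.Structures using (IsCommutativeRing)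
  import Relation.Binary.Reasoning.Setoid
  open import Relation.Nullary using (yes; no)
  open import Relation.Binary.PropositionalEquality as P using (_≡_)
  open Arithmetic using (prime>1; prime∣pCk)

  infix 4 _≈_
  _≈_ : Expr N → Expr N → Set
  a ≈ b = a ≈[ p ] b

  0e 1e : Expr N
  0e = const (+ 0)
  1e = const (+ 1)

  ≈-isCommutativeRing : IsCommutativeRing _≈_ _⊕_ _⊗_ ⊖_ 0e 1e
  ≈-isCommutativeRing = record
      { isRing = record
        { +-isAbelianGroup = record
          { isGroup = record
            { isMonoid = record
              { isSemigroup = record
                { isMagma = record { isEquivalence = record { refl = ≈refl ; sym = ≈sym ; trans = ≈trans } ; ∙-cong = ⊕-cong }
                ; assoc = λ _ _ _ → ⊕-assoc }
              ; identity = (λ _ → ≈trans ⊕-comm ⊕-idʳ) , (λ _ → ⊕-idʳ) }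
            ; inverse = (λ _ → ≈trans ⊕-comm ⊖-invʳ) , (λ _ → ⊖-invʳ)
            ; ⁻¹-cong = ⊖-cong }
          ; comm = λ _ _ → ⊕-comm }
        ; *-cong = ⊗-cong
        ; *-assoc = λ _ _ _ → ⊗-assoc
        ; *-identity = (λ _ → ≈trans ⊗-comm ⊗-idʳ) , (λ _ → ⊗-idʳ)
        ; distrib = (λ _ _ _ → distrib) , (λ _ _ _ → ≈trans ⊗-comm (≈trans distrib (⊕-cong ⊗-comm ⊗-comm))) }
      ; *-comm = λ _ _ → ⊗-comm }

  ring : CommutativeRing 0ℓ 0ℓ
  ring = record { isCommutativeRing = ≈-isCommutativeRing }

  open CommutativeRing ring public
    using (setoid; isEquivalence; reflexive; +-identityˡ; *-identityˡ; zeroˡ; zeroʳ; distribʳ; -‿inverseˡ;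
           +-isCommutativeMonoid; *-isCommutativeMonoid; semiring; commutativeSemiring; +-monoid)
  module ≈-Reasoning = Relation.Binary.Reasoning.Setoid setoid
  open ≈-Reasoning
  open import Algebra.Definitions.RawMonoid (CommutativeRing.+-rawMonoid ring) public using (_×_)
  open import Algebra.Properties.Monoid.Mult +-monoid using (×-congʳ; ×-assocˡ)
  open import Algebra.Properties.Semiring.Exp semiring public using (_^_)
  open import Algebra.Properties.Semiring.Exp semiring using (^-homo-*; ^-assocʳ; ^-congˡ)
  open import Algebra.Properties.Monoid.Sum +-monoid using (sum; sum-cong-≋; sum-init-last; sum-replicate-zero)
  import Algebra.Properties.CommutativeSemiring.Binomial commutativeSemiring as Binomial

  pow≡^ : ∀ a k → pow a k ≡ a ^ k
  pow≡^ a zero    = P.refl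
  pow≡^ a (suc k) = P.cong (a ⊗_) (pow≡^ a k)

  sumE-↭ : ∀ {xs ys} → xs ↭ ys → sumE xs ≈ sumE ys
  sumE-↭ xs↭ys = foldr-commMonoid setoid +-isCommutativeMonoid (↭⇒↭ₛ′ isEquivalence xs↭ys)

  prodE-↭ : ∀ {xs ys} → xs ↭ ys → prodE xs ≈ prodE ys
  prodE-↭ xs↭ys = foldr-commMonoid setoid *-isCommutativeMonoid (↭⇒↭ₛ′ isEquivalence xs↭ys)

  sumE-++ : ∀ xs ys → sumE (xs ++ ys) ≈ sumE xs ⊕ sumE ys
  sumE-++ []       ys = ≈sym (+-identityˡ _)
  sumE-++ (x ∷ xs) ys = ≈trans (⊕-cong ≈refl (sumE-++ xs ys)) (≈sym ⊕-assoc)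

  prodE-++ : ∀ xs ys → prodE (xs ++ ys) ≈ prodE xs ⊗ prodE ys
  prodE-++ []       ys = ≈sym (*-identityˡ _)
  prodE-++ (x ∷ xs) ys = ≈trans (⊗-cong ≈refl (prodE-++ xs ys)) (≈sym ⊗-assoc)

  module _ {A : Set} where

    sumE-map-cong : ∀ {f g : A → Expr N} xs → (∀ {x} → x ∈ xs → f x ≈ g x) → sumE (map f xs) ≈ sumE (map g xs)
    sumE-map-cong []       f≈g = ≈refl
    sumE-map-cong (x ∷ xs) f≈g = ⊕-cong (f≈g (here P.refl)) (sumE-map-cong xs (f≈g ∘ there))

    prodE-map-cong : ∀ {f g : A → Expr N} xs → (∀ {x} → x ∈ xs → f x ≈ g x) → prodE (map f xs) ≈ prodE (map g xs)
    prodE-map-cong []       f≈g = ≈refl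
    prodE-map-cong (x ∷ xs) f≈g = ⊗-cong (f≈g (here P.refl)) (prodE-map-cong xs (f≈g ∘ there))

    sumE-map-const : ∀ {f : A → Expr N} {c} xs → (∀ {x} → x ∈ xs → f x ≈ c) → sumE (map f xs) ≈ length xs × c
    sumE-map-const []       f≈c = ≈refl
    sumE-map-const (x ∷ xs) f≈c = ⊕-cong (f≈c (here P.refl)) (sumE-map-const xs (f≈c ∘ there))

    prodE-map-const : ∀ {f : A → Expr N} {c} xs → (∀ {x} → x ∈ xs → f x ≈ c) → prodE (map f xs) ≈ c ^ length xs
    prodE-map-const []       f≈c = ≈refl
    prodE-map-const (x ∷ xs) f≈c = ⊗-cong (f≈c (here P.refl)) (prodE-map-const xs (f≈c ∘ there))

    prodE-concatMap : ∀ {B : Set} (f : B → Expr N) (g : A → List B) xs →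
                      prodE (map f (concatMap g xs)) ≈ prodE (map (λ x → prodE (map f (g x))) xs)
    prodE-concatMap f g []       = ≈refl
    prodE-concatMap f g (x ∷ xs) = begin
      prodE (map f (g x ++ concatMap g xs))                    ≡⟨ P.cong prodE (map-++ f (g x) (concatMap g xs)) ⟩
      prodE (map f (g x) ++ map f (concatMap g xs))            ≈⟨ prodE-++ (map f (g x)) _ ⟩
      prodE (map f (g x)) ⊗ prodE (map f (concatMap g xs))     ≈⟨ ⊗-cong ≈refl (prodE-concatMap f g xs) ⟩
      prodE (map f (g x)) ⊗ prodE (map (λ x → prodE (map f (g x))) xs) ∎

  ×≈const⊗ : ∀ n a → n × a ≈ const (+ n) ⊗ a
  ×≈const⊗ zero    a = ≈sym (zeroˡ a)
  ×≈const⊗ (suc n) a = begin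
    a ⊕ n × a                         ≈⟨ ⊕-cong (≈sym (*-identityˡ a)) (×≈const⊗ n a) ⟩
    1e ⊗ a ⊕ const (+ n) ⊗ a          ≈⟨ distribʳ a 1e _ ⟨
    (1e ⊕ const (+ n)) ⊗ a            ≈⟨ ⊗-cong const-+ ≈refl ⟩
    const (+ suc n) ⊗ a               ∎

  p≈0 : const (+ p) ≈ 0e
  p≈0 = gen gen-p

  p∣n⇒n×≈0 : ∀ {n} a → p ∣ n → n × a ≈ 0e
  p∣n⇒n×≈0 a (divides c P.refl) = begin
    (c ℕ.* p) × a       ≈⟨ ×-assocˡ a c p ⟨
    c × (p × a)         ≈⟨ ×-congʳ c (≈trans (×≈const⊗ p a) (≈trans (⊗-cong p≈0 ≈refl) (zeroˡ a))) ⟩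
    c × 0e              ≈⟨ ×≈const⊗ c 0e ⟩
    const (+ c) ⊗ 0e    ≈⟨ zeroʳ _ ⟩
    0e                  ∎

  ⊝≈0⇒≈ : ∀ {a b} → a ⊝ b ≈ 0e → a ≈ b
  ⊝≈0⇒≈ {a} {b} a-b≈0 = begin
    a                   ≈⟨ ⊕-idʳ ⟨
    a ⊕ 0e              ≈⟨ ⊕-cong ≈refl (-‿inverseˡ b) ⟨
    a ⊕ (⊖ b ⊕ b)       ≈⟨ ⊕-assoc ⟨
    (a ⊝ b) ⊕ b         ≈⟨ ⊕-cong a-b≈0 ≈refl ⟩
    0e ⊕ b              ≈⟨ +-identityˡ b ⟩
    b                   ∎

  sum≈first⊕last : ∀ m (t : Fin (suc m) → Expr N) → 1 ≤ m → (∀ k → 0 < toℕ k → toℕ k < m → t k ≈ 0e) →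
                sum t ≈ t Fin.zero ⊕ t (fromℕ m)
  sum≈first⊕last (suc n) t _ inner≈0 = ⊕-cong ≈refl (begin
    sum (t ∘ Fin.suc)                                    ≈⟨ sum-init-last (t ∘ Fin.suc) ⟩
    sum (t ∘ Fin.suc ∘ inject₁) ⊕ t (fromℕ (suc n))      ≈⟨ ⊕-cong (sum-cong-≋ inits≈0) ≈refl ⟩
    sum {n} (λ _ → 0e) ⊕ t (fromℕ (suc n))               ≈⟨ ⊕-cong (sum-replicate-zero n) ≈refl ⟩
    0e ⊕ t (fromℕ (suc n))                               ≈⟨ +-identityˡ _ ⟩
    t (fromℕ (suc n))                                    ∎)
    where
    inits≈0 : ∀ k → t (Fin.suc (inject₁ k)) ≈ 0e
    inits≈0 k = inner≈0 (Fin.suc (inject₁ k)) (s≤s z≤n) (s≤s (P.subst (_< n) (P.sym (toℕ-inject₁ k)) (toℕ<n k)))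

  module _ (pr : Prime p) where

    private
      binomialTerm-p≈a^p : ∀ a b j → j ≡ p → (p C j) × (a ^ j ⊗ b ^ (p ℕ.∸ j)) ≈ a ^ p
      binomialTerm-p≈a^p a b j P.refl rewrite nCn≡1 p | ℕ.n∸n≡0 p = ≈trans ⊕-idʳ ⊗-idʳ

    frobenius : ∀ a b → (a ⊕ b) ^ p ≈ a ^ p ⊕ b ^ p
    frobenius a b = begin
      (a ⊕ b) ^ p                         ≈⟨ Binomial.theorem p a b ⟩
      sum (binomialTerm p)                ≈⟨ sum≈first⊕last p (binomialTerm p) (ℕ.<⇒≤ (prime>1 pr))
                                               (λ k 0<k k<p → p∣n⇒n×≈0 _ (prime∣pCk pr 0<k k<p)) ⟩
      binomialTerm p Fin.zero ⊕ binomialTerm p (fromℕ p)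
                                          ≈⟨ ⊕-cong (≈trans ⊕-idʳ (*-identityˡ _)) (binomialTerm-p≈a^p a b _ (toℕ-fromℕ p)) ⟩
      b ^ p ⊕ a ^ p                       ≈⟨ ⊕-comm ⟩
      a ^ p ⊕ b ^ p                       ∎
      where binomialTerm = Binomial.binomialTerm a b

    private
      -1⊗-1≈1 : ⊖ 1e ⊗ ⊖ 1e ≈ 1e
      -1⊗-1≈1 = ≈trans (⊗-cong const-- const--) const-*

      -1^[2k]≈1 : ∀ k → (⊖ 1e) ^ (k ℕ.* 2) ≈ 1e
      -1^[2k]≈1 zero    = ≈refl
      -1^[2k]≈1 (suc k) = ≈trans (≈sym ⊗-assoc) (≈trans (⊗-cong -1⊗-1≈1 (-1^[2k]≈1 k)) (*-identityˡ _))

    [y-1]^p≈y-1 : p % 2 ≡ 1 → (yv ⊝ 1e) ^ p ≈ yv ⊝ 1e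
    [y-1]^p≈y-1 odd = ≈trans (frobenius yv (⊖ 1e)) (⊕-cong (P.subst (_≈ yv) (pow≡^ yv p) (⊝≈0⇒≈ (gen gen-y))) -1^p≈-1)
      where
      -1^p≈-1 : (⊖ 1e) ^ p ≈ ⊖ 1e
      -1^p≈-1 = P.subst (λ k → (⊖ 1e) ^ k ≈ ⊖ 1e)
                  (P.sym (P.trans (m≡m%n+[m/n]*n p 2) (P.cong (ℕ._+ p / 2 ℕ.* 2) odd)))
                  (≈trans (⊗-cong ≈refl (-1^[2k]≈1 (p / 2))) ⊗-idʳ)

    private
      0^p≈0 : 0e ^ p ≈ 0e
      0^p≈0 = P.subst (λ k → 0e ^ k ≈ 0e) (ℕ.m+[n∸m]≡n (ℕ.<⇒≤ (prime>1 pr))) (zeroˡ _)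

    xv^p≈xv : ∀ k → xv N k ^ p ≈ xv N k
    xv^p≈xv zero    = 0^p≈0
    xv^p≈xv (suc j) with j ℕ.<? N
    ... | yes j<N = P.subst (_≈ var (fromℕ< j<N)) (pow≡^ _ p) (⊝≈0⇒≈ (gen (gen-x (fromℕ< j<N))))
    ... | no  _   = 0^p≈0

    xv[p*c]≈xv[c] : ∀ c → 1 ≤ c → p ℕ.* c ≤ N → xv N (p ℕ.* c) ≈ xv N c
    xv[p*c]≈xv[c] (suc i) _ pc≤N with p ℕ.* suc i in pc≡ | ℕ.m≤n*m (suc i) p {{prime⇒nonZero pr}}
    ... | suc j | 1+i≤1+j with j ℕ.<? N | i ℕ.<? N
    ...   | yes j<N | yes i<N = ⊝≈0⇒≈ (gen (gen-xpk (fromℕ< i<N) (fromℕ< j<N) indices))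
      where
      indices : suc (toℕ (fromℕ< j<N)) ≡ p ℕ.* suc (toℕ (fromℕ< i<N))
      indices rewrite toℕ-fromℕ< j<N | toℕ-fromℕ< i<N = P.sym pc≡
    ...   | no j≮N  | _       = ⊥-elim (j≮N pc≤N)
    ...   | yes _   | no i≮N  = ⊥-elim (i≮N (ℕ.≤-trans 1+i≤1+j pc≤N))

    module _ {c} (c^p≈c : c ^ p ≈ c) where

      ^[p*a]≈^a : ∀ a → c ^ (p ℕ.* a) ≈ c ^ a
      ^[p*a]≈^a a = ≈trans (≈sym (^-assocʳ c p a)) (^-congˡ a c^p≈c)

      private
        ^[1+a+[p-1]]≈^[1+a] : ∀ a → c ^ (suc a ℕ.+ (p ℕ.∸ 1)) ≈ c ^ suc a
        ^[1+a+[p-1]]≈^[1+a] a = begin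
          c ^ (suc a ℕ.+ (p ℕ.∸ 1))   ≡⟨ P.cong (c ^_) exponent ⟩
          c ^ (a ℕ.+ p)               ≈⟨ ^-homo-* c a p ⟩
          c ^ a ⊗ c ^ p               ≈⟨ ⊗-cong ≈refl c^p≈c ⟩
          c ^ a ⊗ c                   ≈⟨ ⊗-comm ⟩
          c ^ suc a                   ∎
          where
          exponent : suc a ℕ.+ (p ℕ.∸ 1) ≡ a ℕ.+ p
          exponent = P.trans (P.sym (ℕ.+-suc a (p ℕ.∸ 1))) (P.cong (a ℕ.+_) (ℕ.m+[n∸m]≡n (ℕ.<⇒≤ (prime>1 pr))))

      ^[1+a+[p-1]s]≈^[1+a] : ∀ a s → c ^ (suc a ℕ.+ (p ℕ.∸ 1) ℕ.* s) ≈ c ^ suc a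
      ^[1+a+[p-1]s]≈^[1+a] a zero    =
        reflexive (P.cong (c ^_) (P.trans (P.cong (suc a ℕ.+_) (ℕ.*-zeroʳ (p ℕ.∸ 1))) (ℕ.+-identityʳ (suc a))))
      ^[1+a+[p-1]s]≈^[1+a] a (suc s) = begin
        c ^ (suc a ℕ.+ q ℕ.* suc s)         ≡⟨ P.cong (c ^_) exponent ⟩
        c ^ (suc (a ℕ.+ q ℕ.* s) ℕ.+ q)     ≈⟨ ^[1+a+[p-1]]≈^[1+a] (a ℕ.+ q ℕ.* s) ⟩
        c ^ (suc a ℕ.+ q ℕ.* s)             ≈⟨ ^[1+a+[p-1]s]≈^[1+a] a s ⟩
        c ^ suc a                           ∎
        where
        q = p ℕ.∸ 1
        exponent : suc a ℕ.+ q ℕ.* suc s ≡ suc (a ℕ.+ q ℕ.* s) ℕ.+ q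
        exponent = P.cong suc (P.trans (P.cong (a ℕ.+_) (P.trans (ℕ.*-suc q s) (ℕ.+-comm q (q ℕ.* s))))
                                       (P.sym (ℕ.+-assoc a (q ℕ.* s) q)))

      ^-exponent-shift : ∀ a b s → a ℕ.+ (p ℕ.∸ 1) ℕ.* s ≡ p ℕ.* b → (1 ≤ s → 1 ≤ a) → c ^ a ≈ c ^ b
      ^-exponent-shift a b zero    a+0≡pb _ = begin
        c ^ a             ≡⟨ P.cong (c ^_) (P.trans (P.sym (ℕ.+-identityʳ a)) (P.trans (P.cong (a ℕ.+_) (P.sym (ℕ.*-zeroʳ (p ℕ.∸ 1)))) a+0≡pb)) ⟩
        c ^ (p ℕ.* b)     ≈⟨ ^[p*a]≈^a b ⟩
        c ^ b             ∎
      ^-exponent-shift a b (suc s) a+qs≡pb 1≤s⇒1≤a with a | 1≤s⇒1≤a (s≤s z≤n)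
      ... | suc a′ | _ = begin
        c ^ suc a′                               ≈⟨ ^[1+a+[p-1]s]≈^[1+a] a′ (suc s) ⟨
        c ^ (suc a′ ℕ.+ (p ℕ.∸ 1) ℕ.* suc s)     ≡⟨ P.cong (c ^_) a+qs≡pb ⟩
        c ^ (p ℕ.* b)                            ≈⟨ ^[p*a]≈^a b ⟩
        c ^ b                                    ∎

module OrbitSum {X : Set} (_≟_ : DecidableEquality X) (σ : X → X) {p : ℕ} (pr : Prime p)
                    (σ^p≡id : ∀ x → iter p σ x ≡ x) (N : ℕ) where

  open import Relation.Binary.PropositionalEquality
  open import Data.Nat using (zero; suc; _+_; _∸_; _≤_; s≤s)
  open import Data.Nat.Properties using (≤-trans)
  open import Data.Nat.Primality using (prime⇒nonZero)
  open import Data.List using (List; _++_; map; filter; length)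
  open import Data.List.Properties using (map-++; filter-++; filter-none; filter-notAll; filter-all)
  open import Data.List.Membership.Propositional using (_∈_; _∉_; find; lose)
  open import Data.List.Membership.Propositional.Properties using (∈-filter⁺; ∈-filter⁻; ∈-++⁺ˡ; ∈-++⁺ʳ; ∈-++⁻)
  open import Data.List.Membership.DecPropositional _≟_ using (_∈?_)
  open import Data.List.Relation.Unary.All as All using (All; all?)
  open import Data.List.Relation.Unary.All.Properties using (¬All⇒Any¬)
  open import Data.List.Relation.Unary.Unique.Propositional using (Unique)
  import Data.List.Relation.Unary.Unique.Propositional.Properties as Unique
  open import Data.List.Relation.Binary.Permutation.Propositional using (_↭_; ↭-trans; ↭-reflexive)
  import Data.List.Relation.Binary.Permutation.Propositional.Properties as Perm
  open import Data.Product using (_,_; proj₁; proj₂)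
  open import Data.Nat.Divisibility using (∣-refl)
  open import Data.Sum using (inj₁; inj₂)
  open import Function using (_∘_)
  open import Relation.Nullary using (¬_; Dec; yes; no; ¬?)
  open import Relation.Unary using (∁)
  open Iteration using (iter-+; iter-comm; module Periodic)
  open Lists using (unique∧same-members⇒↭)
  open QuotientRing p N using (_≈_; 0e; _×_; reflexive; +-identityˡ; sumE-↭; sumE-++; sumE-map-const; p∣n⇒n×≈0; module ≈-Reasoning)

  private instance _ = prime⇒nonZero pr
  open Periodic σ p σ^p≡id

  Fixed : X → Set
  Fixed x = σ x ≡ x

  fixed? : ∀ x → Dec (Fixed x)
  fixed? x = σ x ≟ x

  Closed : List X → Set
  Closed L = ∀ {x} → x ∈ L → σ x ∈ L

  module _ {x} (¬fixed : ¬ Fixed x) where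

    non-fixed⇒orbit-unique : Unique (orbit x)
    non-fixed⇒orbit-unique = orbit-unique x λ d 0<d d<p σᵈx≡x →
      ¬fixed (sym (related-to-iterate⇒related-to-σ pr _≡_ refl trans (cong σ) 0<d d<p (sym σᵈx≡x)))

    orbit-non-fixed : All (∁ Fixed) (orbit x)
    orbit-non-fixed = All.tabulate λ y∈ σy≡y → ¬fixed (σ-fixed y∈ σy≡y)
      where
      σ-fixed : ∀ {y} → y ∈ orbit x → Fixed y → Fixed x
      σ-fixed y∈ σy≡y with ∈-orbit⁻ x y∈
      ... | i , _ , refl = iter-injective i (trans (iter-comm σ i x) σy≡y)

  ∈-orbit-σ⁻¹ : ∀ {x y} → σ y ∈ orbit x → y ∈ orbit x
  ∈-orbit-σ⁻¹ {x} {y} σy∈ with ∈-orbit⁻ x σy∈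
  ... | i , _ , σy≡σⁱx = subst (_∈ orbit x) y≡ (∈-orbit⁺ x (p ∸ 1 + i))
    where
    y≡ : iter (p ∸ 1 + i) σ x ≡ y
    y≡ = trans (iter-+ σ (p ∸ 1) i x) (trans (cong σ⁻¹ (sym σy≡σⁱx)) (σ⁻¹∘σ y))

  module _ {L} (!L : Unique L) (closed : Closed L) {x} (x∈L : x ∈ L) (¬fixed : ¬ Fixed x) where

    private
      outside? : ∀ y → Dec (y ∉ orbit x)
      outside? y = ¬? (y ∈? orbit x)

    outside-orbit : List X
    outside-orbit = filter outside? L

    outside-orbit-unique : Unique outside-orbit
    outside-orbit-unique = Unique.filter⁺ outside? !L

    outside-orbit-closed : Closed outside-orbit
    outside-orbit-closed y∈ with ∈-filter⁻ outside? {xs = L} y∈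
    ... | y∈L , y∉orbit = ∈-filter⁺ outside? (closed y∈L) (y∉orbit ∘ ∈-orbit-σ⁻¹)

    length-outside-orbit : suc (length outside-orbit) ≤ length L
    length-outside-orbit = filter-notAll outside? L (lose x∈L (λ x∉ → x∉ (∈-orbit⁺ x 0)))

    ↭-orbit++outside-orbit : L ↭ orbit x ++ outside-orbit
    ↭-orbit++outside-orbit = unique∧same-members⇒↭ !L
      (Unique.++⁺ (non-fixed⇒orbit-unique ¬fixed) outside-orbit-unique
        (λ (y∈orbit , y∈outside) → proj₂ (∈-filter⁻ outside? {xs = L} y∈outside) y∈orbit))
      to from
      where
      iterates∈L : ∀ i → iter i σ x ∈ L
      iterates∈L zero    = x∈L
      iterates∈L (suc i) = closed (iterates∈L i)
      to : ∀ {y} → y ∈ L → y ∈ orbit x ++ outside-orbit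
      to {y} y∈L with y ∈? orbit x
      ... | yes y∈orbit = ∈-++⁺ˡ y∈orbit
      ... | no  y∉orbit = ∈-++⁺ʳ (orbit x) (∈-filter⁺ outside? y∈L y∉orbit)
      from : ∀ {y} → y ∈ orbit x ++ outside-orbit → y ∈ L
      from y∈ with ∈-++⁻ (orbit x) y∈
      ... | inj₂ y∈outside = proj₁ (∈-filter⁻ outside? {xs = L} y∈outside)
      ... | inj₁ y∈orbit with ∈-orbit⁻ x y∈orbit
      ...   | i , _ , refl = iterates∈L i

  module _ (f : X → Expr N) (f∘σ≈f : ∀ x → f (σ x) ≈ f x) where

    private
      f-iter≈f : ∀ i x → f (iter i σ x) ≈ f x
      f-iter≈f zero    x = ≈refl
      f-iter≈f (suc i) x = ≈trans (f∘σ≈f _) (f-iter≈f i x)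

    sumE-orbit≈0 : ∀ x → sumE (map f (orbit x)) ≈ 0e
    sumE-orbit≈0 x = ≈trans (sumE-map-const (orbit x) f-orbit≈fx)
                            (subst (λ k → k × f x ≈ 0e) (sym (length-orbit x)) (p∣n⇒n×≈0 (f x) ∣-refl))
      where
      f-orbit≈fx : ∀ {y} → y ∈ orbit x → f y ≈ f x
      f-orbit≈fx y∈ with ∈-orbit⁻ x y∈
      ... | i , _ , refl = f-iter≈f i x

    sumE≈sumE-fixed : ∀ k L → length L ≤ k → Unique L → Closed L →
                      sumE (map f L) ≈ sumE (map f (filter fixed? L))
    sumE≈sumE-fixed k L len≤k !L closed with all? fixed? L
    ... | yes all-fixed = reflexive (cong (sumE ∘ map f) (sym (filter-all fixed? all-fixed)))
    ... | no  ¬all-fixed with find (¬All⇒Any¬ fixed? L ¬all-fixed)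
    ...   | x , x∈L , ¬fixed = remove-orbit k (≤-trans (length-outside-orbit !L closed x∈L ¬fixed) len≤k)
      where
      rest = outside-orbit !L closed x∈L ¬fixed
      fixed-↭ : filter fixed? L ↭ filter fixed? rest
      fixed-↭ = ↭-trans (Perm.filter-↭ fixed? (↭-orbit++outside-orbit !L closed x∈L ¬fixed))
                        (↭-reflexive (trans (filter-++ fixed? (orbit x) rest)
                                            (cong (_++ filter fixed? rest) (filter-none fixed? (orbit-non-fixed ¬fixed)))))
      remove-orbit : ∀ k → suc (length rest) ≤ k → sumE (map f L) ≈ sumE (map f (filter fixed? L))
      remove-orbit (suc k) (s≤s len≤k) = begin
        sumE (map f L)                                    ≈⟨ sumE-↭ (Perm.map⁺ f (↭-orbit++outside-orbit !L closed x∈L ¬fixed)) ⟩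
        sumE (map f (orbit x ++ rest))                    ≡⟨ cong sumE (map-++ f (orbit x) rest) ⟩
        sumE (map f (orbit x) ++ map f rest)              ≈⟨ sumE-++ (map f (orbit x)) (map f rest) ⟩
        sumE (map f (orbit x)) ⊕ sumE (map f rest)        ≈⟨ ⊕-cong (sumE-orbit≈0 x)
                                                                (sumE≈sumE-fixed k rest len≤k
                                                                  (outside-orbit-unique !L closed x∈L ¬fixed)
                                                                  (outside-orbit-closed !L closed x∈L ¬fixed)) ⟩
        0e ⊕ sumE (map f (filter fixed? rest))            ≈⟨ +-identityˡ _ ⟩
        sumE (map f (filter fixed? rest))                 ≈⟨ sumE-↭ (Perm.map⁺ f fixed-↭) ⟨
        sumE (map f (filter fixed? L))                    ∎
        where open ≈-Reasoning

module Connectivity {n m : ℕ} (G : Graph n m) where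

  open import Data.Nat as ℕ using (zero; suc; _+_; _∸_; _≤_; _<_; z≤n; s≤s; _≤ᵇ_)
  import Data.Nat.Properties as ℕ
  open import Data.Fin as Fin using (Fin; toℕ)
  open import Data.Fin.Properties using (toℕ-injective)
  open import Data.Fin.Subset as Subset using (Subset; ⁅_⁆; ∣_∣)
  import Data.Fin.Subset.Properties as Subset
  open import Data.Vec using (Vec; []; _∷_; lookup; _[_]≔_)
  import Data.Vec.Properties as Vec
  open import Data.Bool as Bool using (Bool; true; false; _∧_; _∨_; not)
  open import Data.Bool.Properties using (T-≡; ¬-not)
  open import Data.List using (List; []; _∷_; allFin; filter; length; map)
  open import Data.List.Properties using (length-map; length-tabulate)
  open import Data.List.Membership.Propositional using (_∈_)
  open import Data.List.Membership.Propositional.Properties using (∈-allFin; ∈-filter⁺; ∈-filter⁻; ∈-map⁺; ∈-map⁻)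
  open import Data.List.Relation.Unary.Any using (there)
  open import Data.List.Relation.Unary.Unique.Propositional using (Unique; []; _∷_)
  import Data.List.Relation.Unary.Unique.Propositional.Properties as Unique
  open import Data.List.Relation.Binary.Permutation.Propositional using (_↭_)
  open import Data.List.Relation.Binary.Permutation.Propositional.Properties using (↭-length)
  open import Data.Product using (∃; _×_; _,_; proj₁; proj₂)
  open import Data.Sum using (_⊎_; inj₁; inj₂)
  open import Data.Empty using (⊥; ⊥-elim)
  open import Function using (_∘_; id)
  open import Function.Bundles using (Equivalence)
  open import Relation.Nullary using (¬_; Dec; yes; no)
  open import Relation.Binary.PropositionalEquality
  open import Relation.Binary.Construct.Closure.ReflexiveTransitive as Star using (Star; ε; _◅_; _◅◅_)
  open Iteration using (iter-+; iter-fixed)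
  open Lists
  open Subsets

  data Adj (A : Subset m) (u w : Fin n) : Set where
    edge : ∀ e → lookup A e ≡ true → ends G e ≡ᵤ (u , w) → Adj A u w

  Reach : Subset m → Fin n → Fin n → Set
  Reach A = Star (Adj A)

  adj-sym : ∀ {A u w} → Adj A u w → Adj A w u
  adj-sym (edge e e∈A (inj₁ ends≡)) = edge e e∈A (inj₂ ends≡)
  adj-sym (edge e e∈A (inj₂ ends≡)) = edge e e∈A (inj₁ ends≡)

  reach-sym : ∀ {A u w} → Reach A u w → Reach A w u
  reach-sym {A} = Star.reverse (adj-sym {A})

  reach-adj : ∀ {A u w} → Adj A u w → Reach A u w
  reach-adj a = a ◅ ε

  private
    ==-refl : ∀ {k} (a : Fin k) → (a == a) ≡ true
    ==-refl a with a Fin.≟ a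
    ... | yes _   = refl
    ... | no  a≢a = ⊥-elim (a≢a refl)

    ==⇒≡ : ∀ {k} {a b : Fin k} → (a == b) ≡ true → a ≡ b
    ==⇒≡ {a = a} {b} a==b with a Fin.≟ b
    ... | yes a≡b = a≡b

    joins : Subset m → Subset n → Fin m → Fin n → Bool
    joins A S e v = lookup A e ∧ ( (lookup S (proj₁ (ends G e)) ∧ (proj₂ (ends G e) == v))
                                 ∨ (lookup S (proj₂ (ends G e)) ∧ (proj₁ (ends G e) == v)))

    lookup-step : ∀ A S v → lookup (step G A S) v ≡ lookup S v ∨ anyL (λ e → joins A S e v) (allFin m)
    lookup-step A S v = trans (Vec.lookup-zipWith _∨_ v S _) (cong (lookup S v ∨_) (Vec.lookup∘tabulate _ v))

  step-⊇ : ∀ A S w → lookup S w ≡ true → lookup (step G A S) w ≡ true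
  step-⊇ A S w w∈S = trans (lookup-step A S w) (≡true⇒∨ˡ _ w∈S)

  step-adj : ∀ A S {u w} → lookup S u ≡ true → Adj A u w → lookup (step G A S) w ≡ true
  step-adj A S {u} {w} u∈S (edge e e∈A ends≡) =
    trans (lookup-step A S w) (≡true⇒∨ʳ (lookup S w) (anyL≡true⁺ (λ e → joins A S e w) (∈-allFin e) (joins≡true ends≡)))
    where
    joins≡true : ends G e ≡ᵤ (u , w) → joins A S e w ≡ true
    joins≡true (inj₁ ends≡) rewrite ends≡ | e∈A | u∈S | ==-refl w = refl
    joins≡true (inj₂ ends≡) rewrite ends≡ | e∈A | u∈S | ==-refl w = ≡true⇒∨ʳ (lookup S w ∧ (u == w)) refl

  step-inv : ∀ A S w → lookup (step G A S) w ≡ true → lookup S w ≡ true ⊎ ∃ λ u → lookup S u ≡ true × Adj A u w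
  step-inv A S w w∈step with ∨≡true (trans (sym (lookup-step A S w)) w∈step)
  ... | inj₁ w∈S = inj₁ w∈S
  ... | inj₂ some-edge with anyL≡true⁻ _ (allFin m) some-edge
  ... | e , _ , joins≡t with ends G e in ends≡
  ... | (x , y) with ∧≡true {lookup A e} joins≡t
  ... | e∈A , either with ∨≡true either
  ... | inj₁ x∈S∧y==w = let x∈S , y==w = ∧≡true x∈S∧y==w in
        inj₂ (x , x∈S , edge e e∈A (inj₁ (trans ends≡ (cong (x ,_) (==⇒≡ y==w)))))
  ... | inj₂ y∈S∧x==w = let y∈S , x==w = ∧≡true y∈S∧x==w in
        inj₂ (y , y∈S , edge e e∈A (inj₂ (trans ends≡ (cong (_, y) (==⇒≡ x==w)))))

  closure : Subset m → Fin n → ℕ → Subset n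
  closure A v k = iter k (step G A) ⁅ v ⁆

  closure-sound : ∀ A v k {w} → lookup (closure A v k) w ≡ true → Reach A v w
  closure-sound A v zero    w∈ rewrite Subset.x∈⁅y⁆⇒x≡y _ (Vec.lookup⇒[]= _ ⁅ v ⁆ w∈) = ε
  closure-sound A v (suc k) w∈ with step-inv A (closure A v k) _ w∈
  ... | inj₁ w∈closure         = closure-sound A v k w∈closure
  ... | inj₂ (u , u∈ , u~w)    = closure-sound A v k u∈ ◅◅ reach-adj u~w

  closure-∋ : ∀ A v k → lookup (closure A v k) v ≡ true
  closure-∋ A v zero    = Vec.[]=⇒lookup (Subset.x∈⁅x⁆ v)
  closure-∋ A v (suc k) = step-⊇ A (closure A v k) v (closure-∋ A v k)

  private
    step-⊆ : ∀ A S → S Subset.⊆ step G A S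
    step-⊆ A S = lookup-⊆ (step-⊇ A S _)

    -- Every proper closure step adds a vertex, so there are at most n proper steps.
    closure-stabilises-or-grows : ∀ A v k → (∃ λ j → j ≤ k × step G A (closure A v j) ≡ closure A v j)
                                            ⊎ suc k ≤ ∣ closure A v k ∣
    closure-stabilises-or-grows A v zero = inj₂ (ℕ.≤-reflexive (sym (Subset.∣⁅x⁆∣≡1 v)))
    closure-stabilises-or-grows A v (suc k) with closure-stabilises-or-grows A v k
    ... | inj₁ (j , j≤k , stable) = inj₁ (j , ℕ.m≤n⇒m≤1+n j≤k , stable)
    ... | inj₂ k<size with Vec.≡-dec Bool._≟_ (step G A (closure A v k)) (closure A v k)
    ...   | yes stable = inj₁ (k , ℕ.n≤1+n k , stable)
    ...   | no  grows  = inj₂ (ℕ.≤-trans (s≤s k<size)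
                                  (Subset.p⊂q⇒∣p∣<∣q∣ (⊆∧≢⇒⊂ (step-⊆ A (closure A v k)) grows)))

  step-comp : ∀ A v → step G A (comp G A v) ≡ comp G A v
  step-comp A v with closure-stabilises-or-grows A v n
  ... | inj₂ n<size = ⊥-elim (ℕ.<⇒≱ n<size (Subset.∣p∣≤n (comp G A v)))
  ... | inj₁ (j , j≤n , stable) = subst (λ S → step G A S ≡ S) (sym comp≡closure-j) stable
    where
    comp≡closure-j : comp G A v ≡ closure A v j
    comp≡closure-j = begin
      iter n (step G A) ⁅ v ⁆                          ≡⟨ cong (λ k → iter k (step G A) ⁅ v ⁆) (ℕ.m∸n+n≡m j≤n) ⟨
      iter (n ∸ j + j) (step G A) ⁅ v ⁆                ≡⟨ iter-+ (step G A) (n ∸ j) j ⁅ v ⁆ ⟩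
      iter (n ∸ j) (step G A) (closure A v j)          ≡⟨ iter-fixed (step G A) stable (n ∸ j) ⟩
      closure A v j                                    ∎
      where open ≡-Reasoning

  comp-sound : ∀ A v {w} → lookup (comp G A v) w ≡ true → Reach A v w
  comp-sound A v = closure-sound A v n

  comp-complete : ∀ A v {w} → Reach A v w → lookup (comp G A v) w ≡ true
  comp-complete A v = go (closure-∋ A v n)
    where
    go : ∀ {u w} → lookup (comp G A v) u ≡ true → Reach A u w → lookup (comp G A v) w ≡ true
    go u∈ ε          = u∈
    go u∈ (u~z ◅ z⇝w) = go (subst (λ S → lookup S _ ≡ true) (step-comp A v) (step-adj A (comp G A v) u∈ u~z)) z⇝w

  1≤∣comp∣ : ∀ A v → 1 ≤ ∣ comp G A v ∣
  1≤∣comp∣ A v = ℕ.≤-trans (s≤s z≤n) (Subset.x∈p⇒∣p-x∣<∣p∣ {p = comp G A v} (Vec.lookup⇒[]= v _ (comp-complete A v ε)))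

  comp-cong : ∀ A {u w} → Reach A u w → comp G A u ≡ comp G A w
  comp-cong A u⇝w = Subset.⊆-antisym
    (lookup-⊆ λ x∈ → comp-complete A _ (reach-sym u⇝w ◅◅ comp-sound A _ x∈))
    (lookup-⊆ λ x∈ → comp-complete A _ (u⇝w ◅◅ comp-sound A _ x∈))

  IsRep : Subset m → Fin n → Set
  IsRep A v = ∀ {w} → Reach A v w → toℕ v ≤ toℕ w

  isRep-sound : ∀ A v → isRep G A v ≡ true → IsRep A v
  isRep-sound A v rep≡t {w} v⇝w with allL≡true⁻ _ (allFin n) rep≡t (∈-allFin w)
  ... | v≤w rewrite comp-complete A v v⇝w = ℕ.≤ᵇ⇒≤ (toℕ v) (toℕ w) (subst Bool.T (sym v≤w) _)

  isRep-complete : ∀ A v → IsRep A v → isRep G A v ≡ true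
  isRep-complete A v rep = allL≡true⁺ _ (allFin n) (λ {w} _ → least-or-outside w)
    where
    least-or-outside : ∀ w → not (lookup (comp G A v) w) ∨ (toℕ v ≤ᵇ toℕ w) ≡ true
    least-or-outside w with lookup (comp G A v) w in w∈
    ... | false = refl
    ... | true  = Equivalence.to T-≡ (ℕ.≤⇒≤ᵇ (rep (comp-sound A v w∈)))

  reps : Subset m → List (Fin n)
  reps A = filter (λ v → isRep G A v Bool.≟ true) (allFin n)

  reps-unique : ∀ A → Unique (reps A)
  reps-unique A = Unique.filter⁺ (λ v → isRep G A v Bool.≟ true) (Unique.allFin⁺ n)

  ∈-reps⁻ : ∀ {A v} → v ∈ reps A → IsRep A v
  ∈-reps⁻ {A} {v} v∈ = isRep-sound A v (proj₂ (∈-filter⁻ (λ v → isRep G A v Bool.≟ true) {xs = allFin n} v∈))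

  ∈-reps⁺ : ∀ {A v} → IsRep A v → v ∈ reps A
  ∈-reps⁺ {A} {v} rep = ∈-filter⁺ (λ v → isRep G A v Bool.≟ true) (∈-allFin v) (isRep-complete A v rep)

  numComp≡length-reps : ∀ A → numComp G A ≡ length (reps A)
  numComp≡length-reps A = countL≡length-filter (isRep G A) (allFin n)

  rep-unique : ∀ {A r s} → IsRep A r → IsRep A s → Reach A r s → r ≡ s
  rep-unique r-rep s-rep r⇝s = toℕ-injective (ℕ.≤-antisym (r-rep r⇝s) (s-rep (reach-sym r⇝s)))

  private
    least : ∀ {k} (P : Fin k → Set) → (∀ i → Dec (P i)) → ∀ {v} → P v →
            ∃ λ u → P u × (∀ {w} → P w → toℕ u ≤ toℕ w)
    least P P? {Fin.zero}   P0 = Fin.zero , P0 , λ _ → z≤n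
    least P P? {Fin.suc v} Pv with P? Fin.zero
    ... | yes P0 = Fin.zero , P0 , λ _ → z≤n
    ... | no ¬P0 with least (P ∘ Fin.suc) (P? ∘ Fin.suc) Pv
    ...   | u , Pu , u-least = Fin.suc u , Pu , suc-least
      where
      suc-least : ∀ {w} → P w → suc (toℕ u) ≤ toℕ w
      suc-least {Fin.zero}  P0 = ⊥-elim (¬P0 P0)
      suc-least {Fin.suc w} Pw = s≤s (u-least Pw)

    least-in-comp : ∀ A v → ∃ λ r → Reach A v r × (∀ {w} → Reach A v w → toℕ r ≤ toℕ w)
    least-in-comp A v with least (λ w → lookup (comp G A v) w ≡ true) (λ w → lookup (comp G A v) w Bool.≟ true)
                                 (comp-complete A v ε)
    ... | r , r∈ , r-least = r , comp-sound A v r∈ , r-least ∘ comp-complete A v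

  repOf : Subset m → Fin n → Fin n
  repOf A v = proj₁ (least-in-comp A v)

  reach-repOf : ∀ A v → Reach A v (repOf A v)
  reach-repOf A v = proj₁ (proj₂ (least-in-comp A v))

  repOf-least : ∀ A v {w} → Reach A v w → toℕ (repOf A v) ≤ toℕ w
  repOf-least A v = proj₂ (proj₂ (least-in-comp A v))

  repOf-isRep : ∀ A v → IsRep A (repOf A v)
  repOf-isRep A v r⇝w = repOf-least A v (reach-repOf A v ◅◅ r⇝w)

  ¬IsRep⇒smaller : ∀ A v → ¬ IsRep A v → ∃ λ w → Reach A v w × toℕ w < toℕ v
  ¬IsRep⇒smaller A v ¬rep with toℕ (repOf A v) ℕ.<? toℕ v
  ... | yes r<v = repOf A v , reach-repOf A v , r<v
  ... | no  r≮v = ⊥-elim (¬rep λ v⇝w → ℕ.≤-trans (ℕ.≮⇒≥ r≮v) (repOf-least A v v⇝w))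

  record Transversal (A : Subset m) (L : List (Fin n)) : Set where
    field
      unique    : Unique L
      separated : ∀ {x y} → x ∈ L → y ∈ L → Reach A x y → x ≡ y
      covering  : ∀ v → ∃ λ x → x ∈ L × Reach A v x

  module _ {A L} (T : Transversal A L) where
    open Transversal T

    map-repOf↭reps : map (repOf A) L ↭ reps A
    map-repOf↭reps = unique∧same-members⇒↭ (map⁺-injectiveOn (repOf A) unique repOf-injective) (reps-unique A) to from
      where
      repOf-injective : ∀ {a b} → a ∈ L → b ∈ L → repOf A a ≡ repOf A b → a ≡ b
      repOf-injective a∈ b∈ ra≡rb =
        separated a∈ b∈ (reach-repOf A _ ◅◅ subst (λ r → Reach A r _) (sym ra≡rb) (reach-sym (reach-repOf A _)))
      to : ∀ {r} → r ∈ map (repOf A) L → r ∈ reps A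
      to r∈ with ∈-map⁻ (repOf A) r∈
      ... | x , _ , refl = ∈-reps⁺ (repOf-isRep A x)
      from : ∀ {r} → r ∈ reps A → r ∈ map (repOf A) L
      from {r} r∈ with covering r
      ... | x , x∈ , r⇝x = subst (_∈ map (repOf A) L)
                             (sym (rep-unique (∈-reps⁻ r∈) (repOf-isRep A x) (r⇝x ◅◅ reach-repOf A x)))
                             (∈-map⁺ (repOf A) x∈)

    numComp≡length : numComp G A ≡ length L
    numComp≡length = begin
      numComp G A                ≡⟨ numComp≡length-reps A ⟩
      length (reps A)            ≡⟨ ↭-length map-repOf↭reps ⟨
      length (map (repOf A) L)   ≡⟨ length-map (repOf A) L ⟩
      length L                   ∎
      where open ≡-Reasoning

  infixl 6 _+ₑ_
  _+ₑ_ : Subset m → Fin m → Subset m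
  A +ₑ e = A [ e ]≔ true

  module AddEdge (A : Subset m) (e : Fin m) where

    private
      a b : Fin n
      a = proj₁ (ends G e)
      b = proj₂ (ends G e)

      adj-+ₑ⁻ : ∀ {u w} → Adj (A +ₑ e) u w → Adj A u w ⊎ (u , w) ≡ᵤ (a , b)
      adj-+ₑ⁻ (edge e′ e′∈ ends≡) with e′ Fin.≟ e
      ... | yes refl = inj₂ (≡ᵤ-sym ends≡)
      ... | no e′≢e  = inj₁ (edge e′ (trans (sym (Vec.lookup∘update′ e′≢e A true)) e′∈) ends≡)

    ⊆-+ₑ : ∀ e′ → lookup A e′ ≡ true → lookup (A +ₑ e) e′ ≡ true
    ⊆-+ₑ e′ e′∈ with e′ Fin.≟ e
    ... | yes refl = Vec.lookup∘update e A true
    ... | no e′≢e  = trans (Vec.lookup∘update′ e′≢e A true) e′∈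

    reach-+ₑ⁺ : ∀ {u w} → Reach A u w → Reach (A +ₑ e) u w
    reach-+ₑ⁺ = Star.gmap id λ { (edge e′ e′∈ ends≡) → edge e′ (⊆-+ₑ e′ e′∈) ends≡ }

    reach-+ₑ⁻ : ∀ {u w} → Reach (A +ₑ e) u w →
                Reach A u w ⊎ (Reach A u a × Reach A b w) ⊎ (Reach A u b × Reach A a w)
    reach-+ₑ⁻ ε = inj₁ ε
    reach-+ₑ⁻ (u~z ◅ z⇝w) with adj-+ₑ⁻ u~z | reach-+ₑ⁻ z⇝w
    ... | inj₁ u~z           | inj₁ z⇝w                    = inj₁ (u~z ◅ z⇝w)
    ... | inj₁ u~z           | inj₂ (inj₁ (z⇝a , b⇝w))     = inj₂ (inj₁ (u~z ◅ z⇝a , b⇝w))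
    ... | inj₁ u~z           | inj₂ (inj₂ (z⇝b , a⇝w))     = inj₂ (inj₂ (u~z ◅ z⇝b , a⇝w))
    ... | inj₂ (inj₁ refl)   | inj₁ b⇝w                    = inj₂ (inj₁ (ε , b⇝w))
    ... | inj₂ (inj₁ refl)   | inj₂ (inj₁ (b⇝a , b⇝w))     = inj₁ (reach-sym b⇝a ◅◅ b⇝w)
    ... | inj₂ (inj₁ refl)   | inj₂ (inj₂ (_ , a⇝w))       = inj₁ a⇝w
    ... | inj₂ (inj₂ refl)   | inj₁ a⇝w                    = inj₂ (inj₂ (ε , a⇝w))
    ... | inj₂ (inj₂ refl)   | inj₂ (inj₁ (_ , b⇝w))       = inj₁ b⇝w
    ... | inj₂ (inj₂ refl)   | inj₂ (inj₂ (a⇝b , a⇝w))     = inj₁ (reach-sym a⇝b ◅◅ a⇝w)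

    isRep-+ₑ⇒isRep : ∀ {v} → isRep G (A +ₑ e) v ≡ true → isRep G A v ≡ true
    isRep-+ₑ⇒isRep {v} rep = isRep-complete A v λ v⇝w → isRep-sound (A +ₑ e) v rep (reach-+ₑ⁺ v⇝w)

    private
      Lost : Fin n → Set
      Lost v = (Reach A v a × ∃ λ w → Reach A b w × toℕ w < toℕ v)
             ⊎ (Reach A v b × ∃ λ w → Reach A a w × toℕ w < toℕ v)

      lost : ∀ {v} → isRep G A v ≡ true → isRep G (A +ₑ e) v ≡ false → Lost v
      lost {v} rep ¬rep+ with ¬IsRep⇒smaller (A +ₑ e) v (λ rep+ → ≡true⇒≢false (isRep-complete _ v rep+) ¬rep+)
      ... | w , v⇝w , w<v with reach-+ₑ⁻ v⇝w
      ...   | inj₁ v⇝w′                  = ⊥-elim (ℕ.<⇒≱ w<v (isRep-sound A v rep v⇝w′))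
      ...   | inj₂ (inj₁ (v⇝a , b⇝w))    = inj₁ (v⇝a , w , b⇝w , w<v)
      ...   | inj₂ (inj₂ (v⇝b , a⇝w))    = inj₂ (v⇝b , w , a⇝w , w<v)

    at-most-one-lost : ∀ {v₁ v₂} → isRep G A v₁ ≡ true → isRep G (A +ₑ e) v₁ ≡ false →
                                    isRep G A v₂ ≡ true → isRep G (A +ₑ e) v₂ ≡ false → v₁ ≡ v₂
    at-most-one-lost {v₁} {v₂} rep₁ ¬rep₁ rep₂ ¬rep₂ with lost rep₁ ¬rep₁ | lost rep₂ ¬rep₂
    ... | inj₁ (v₁⇝a , _) | inj₁ (v₂⇝a , _) = rep-unique (isRep-sound A v₁ rep₁) (isRep-sound A v₂ rep₂) (v₁⇝a ◅◅ reach-sym v₂⇝a)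
    ... | inj₂ (v₁⇝b , _) | inj₂ (v₂⇝b , _) = rep-unique (isRep-sound A v₁ rep₁) (isRep-sound A v₂ rep₂) (v₁⇝b ◅◅ reach-sym v₂⇝b)
    ... | inj₁ (v₁⇝a , w₁ , b⇝w₁ , w₁<v₁) | inj₂ (v₂⇝b , w₂ , a⇝w₂ , w₂<v₂) =
          ⊥-elim (ℕ.<-asym (ℕ.≤-<-trans (isRep-sound A v₁ rep₁ (v₁⇝a ◅◅ a⇝w₂)) w₂<v₂)
                           (ℕ.≤-<-trans (isRep-sound A v₂ rep₂ (v₂⇝b ◅◅ b⇝w₁)) w₁<v₁))
    ... | inj₂ (v₁⇝b , w₁ , a⇝w₁ , w₁<v₁) | inj₁ (v₂⇝a , w₂ , b⇝w₂ , w₂<v₂) =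
          ⊥-elim (ℕ.<-asym (ℕ.≤-<-trans (isRep-sound A v₁ rep₁ (v₁⇝b ◅◅ b⇝w₂)) w₂<v₂)
                           (ℕ.≤-<-trans (isRep-sound A v₂ rep₂ (v₂⇝a ◅◅ a⇝w₁)) w₁<v₁))

    numComp≤1+numComp-+ₑ : numComp G A ≤ suc (numComp G (A +ₑ e))
    numComp≤1+numComp-+ₑ = countL≤1+countL (isRep G A) (isRep G (A +ₑ e)) (allFin n) (Unique.allFin⁺ n)
                             isRep-+ₑ⇒isRep (λ _ _ → at-most-one-lost)

  private
    nullity-mono′ : ∀ d {A A′} → A Subset.⊆ A′ → ∣ A′ ∣ ∸ ∣ A ∣ ≡ d → ∣ A ∣ + numComp G A ≤ ∣ A′ ∣ + numComp G A′
    nullity-mono′ d {A} {A′} A⊆A′ d≡ with Vec.≡-dec Bool._≟_ A′ A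
    ... | yes refl = ℕ.≤-refl
    ... | no  A′≢A with ⊆∧≢⇒⊂ A⊆A′ A′≢A | d
    ...   | A⊂A′ | zero = ⊥-elim (ℕ.<⇒≱ (Subset.p⊂q⇒∣p∣<∣q∣ A⊂A′) (ℕ.m∸n≡0⇒m≤n d≡))
    ...   | (_ , e , e∈A′ , e∉A) | suc d′ = ℕ.≤-trans add-e (nullity-mono′ d′ A+e⊆A′ d′≡)
      where
      e∉A′ : lookup A e ≡ false
      e∉A′ = ¬-not (e∉A ∘ Vec.lookup⇒[]= e A)
      ∣A+e∣≡ : ∣ A +ₑ e ∣ ≡ suc ∣ A ∣
      ∣A+e∣≡ = ∣[]≔true∣ A e e∉A′
      add-e : ∣ A ∣ + numComp G A ≤ ∣ A +ₑ e ∣ + numComp G (A +ₑ e)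
      add-e = begin
        ∣ A ∣ + numComp G A                    ≤⟨ ℕ.+-monoʳ-≤ ∣ A ∣ (AddEdge.numComp≤1+numComp-+ₑ A e) ⟩
        ∣ A ∣ + suc (numComp G (A +ₑ e))       ≡⟨ ℕ.+-suc ∣ A ∣ _ ⟩
        suc ∣ A ∣ + numComp G (A +ₑ e)         ≡⟨ cong (_+ numComp G (A +ₑ e)) ∣A+e∣≡ ⟨
        ∣ A +ₑ e ∣ + numComp G (A +ₑ e)        ∎
        where open ℕ.≤-Reasoning
      A+e⊆A′ : (A +ₑ e) Subset.⊆ A′
      A+e⊆A′ = lookup-⊆ within
        where
        within : ∀ {x} → lookup (A +ₑ e) x ≡ true → lookup A′ x ≡ true
        within {x} x∈ with x Fin.≟ e
        ... | yes refl = Vec.[]=⇒lookup e∈A′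
        ... | no  x≢e  = Vec.[]=⇒lookup (A⊆A′ (Vec.lookup⇒[]= x A (trans (sym (Vec.lookup∘update′ x≢e A true)) x∈)))
      d′≡ : ∣ A′ ∣ ∸ ∣ A +ₑ e ∣ ≡ d′
      d′≡ = trans (cong (∣ A′ ∣ ∸_) ∣A+e∣≡) (trans (sym (ℕ.pred[m∸n]≡m∸[1+n] ∣ A′ ∣ ∣ A ∣)) (cong ℕ.pred d≡))

  nullity-mono : ∀ {A A′} → A Subset.⊆ A′ → ∣ A ∣ + numComp G A ≤ ∣ A′ ∣ + numComp G A′
  nullity-mono A⊆A′ = nullity-mono′ _ A⊆A′ refl

  numComp-⊥ : numComp G Subset.⊥ ≡ n
  numComp-⊥ = trans (all-reps (allFin n)) (length-tabulate id)
    where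
    no-path : ∀ {v w} → Reach Subset.⊥ v w → v ≡ w
    no-path ε                       = refl
    no-path (edge e e∈⊥ _ ◅ _) = ⊥-elim (≡true⇒≢false e∈⊥ (Vec.lookup-replicate e false))
    all-reps : ∀ vs → countL (isRep G Subset.⊥) vs ≡ length vs
    all-reps []       = refl
    all-reps (v ∷ vs) rewrite isRep-complete Subset.⊥ v (ℕ.≤-reflexive ∘ cong toℕ ∘ no-path) = cong suc (all-reps vs)

  rank≤ : ∀ A → n ≤ ∣ A ∣ + numComp G A
  rank≤ A = subst (_≤ ∣ A ∣ + numComp G A) (cong₂ _+_ (Subset.∣⊥∣≡0 m) numComp-⊥) (nullity-mono (Subset.⊥⊆ {p = A}))

module FreeAction {k k′ : ℕ} (σ : Fin k → Fin k) {p : ℕ} (pr : Prime p)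
  (σ^p≡id : ∀ x → iter p σ x ≡ x)
  (free : ∀ x i → 1 ≤ i → i < p → iter i σ x ≢ x)
  (π : Fin k → Fin k′) (π-surjective : ∀ w → ∃ λ x → π x ≡ w)
  (π-invariant : ∀ i x → π (iter i σ x) ≡ π x)
  (same-π⇒orbit : ∀ {u v} → π u ≡ π v → ∃ λ i → iter i σ u ≡ v) where

  open import Relation.Binary.PropositionalEquality
  open import Data.Nat using (zero; suc; _*_)
  open import Data.Nat.DivMod using (_%_; m%n<n)
  open import Data.Nat.Primality using (prime⇒nonZero)
  open import Data.Fin.Subset as Subset using (Subset; ∣_∣)
  import Data.Fin.Subset.Properties as Subset
  open import Data.Vec using (lookup; tabulate)
  import Data.Vec.Properties as Vec
  open import Data.List using (List; concatMap; length)
  open import Data.List.Membership.Propositional using (_∈_; find; lose)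
  open import Data.List.Membership.Propositional.Properties using (∈-concatMap⁺; ∈-concatMap⁻)
  open import Data.List.Relation.Unary.Unique.Propositional using (Unique)
  open import Data.List.Relation.Binary.Permutation.Propositional.Properties using (↭-length)
  open import Data.Product using (_×_; _,_; proj₁; proj₂)
  open import Data.Bool using (true)
  open import Function using (_∘_)
  open Iteration using (module Periodic)
  open Lists
  open Subsets

  private instance _ = prime⇒nonZero pr
  open Periodic σ p σ^p≡id public

  section : Fin k′ → Fin k
  section w = proj₁ (π-surjective w)

  π∘section : ∀ w → π (section w) ≡ w
  π∘section w = proj₂ (π-surjective w)

  π∘iter : ∀ i x → π (iter i σ x) ≡ π x
  π∘iter = π-invariant

  π∘σ : ∀ x → π (σ x) ≡ π x
  π∘σ = π∘iter 1

  same-π⇒iterate : ∀ {u v} → π u ≡ π v → ∃ λ i → i < p × iter i σ u ≡ v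
  same-π⇒iterate {u} {v} πu≡πv with same-π⇒orbit πu≡πv
  ... | i , σⁱu≡v = i % p , m%n<n i p , trans (iter-% i u) σⁱu≡v

  fibre : Fin k′ → List (Fin k)
  fibre w = orbit (section w)

  fibre-unique : ∀ w → Unique (fibre w)
  fibre-unique w = orbit-unique (section w) λ d 1≤d d<p → free (section w) d 1≤d d<p

  ∈-fibre⁺ : ∀ {x w} → π x ≡ w → x ∈ fibre w
  ∈-fibre⁺ {x} {w} πx≡w with same-π⇒iterate (trans (π∘section w) (sym πx≡w))
  ... | i , _ , σⁱ≡x = subst (_∈ fibre w) σⁱ≡x (∈-orbit⁺ (section w) i)

  ∈-fibre⁻ : ∀ {x w} → x ∈ fibre w → π x ≡ w
  ∈-fibre⁻ {x} {w} x∈ with ∈-orbit⁻ (section w) x∈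
  ... | i , _ , refl = trans (π∘iter i (section w)) (π∘section w)

  length-fibre : ∀ w → length (fibre w) ≡ p
  length-fibre w = length-orbit (section w)

  Invariant : Subset k → Set
  Invariant S = ∀ x → lookup S (σ x) ≡ lookup S x

  invariant-iter : ∀ S → Invariant S → ∀ i x → lookup S (iter i σ x) ≡ lookup S x
  invariant-iter S inv zero    x = refl
  invariant-iter S inv (suc i) x = trans (inv _) (invariant-iter S inv i x)

  lift : Subset k′ → Subset k
  lift S̄ = tabulate (lookup S̄ ∘ π)

  descend : Subset k → Subset k′
  descend S = tabulate (lookup S ∘ section)

  lookup-lift : ∀ S̄ x → lookup (lift S̄) x ≡ lookup S̄ (π x)
  lookup-lift S̄ x = Vec.lookup∘tabulate _ x

  lift-invariant : ∀ S̄ → Invariant (lift S̄)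
  lift-invariant S̄ x = trans (lookup-lift S̄ (σ x)) (trans (cong (lookup S̄) (π∘σ x)) (sym (lookup-lift S̄ x)))

  invariant⇒lift∘descend : ∀ S → Invariant S → lift (descend S) ≡ S
  invariant⇒lift∘descend S inv = lookup-ext λ x → begin
    lookup (lift (descend S)) x           ≡⟨ lookup-lift (descend S) x ⟩
    lookup (descend S) (π x)              ≡⟨ Vec.lookup∘tabulate _ (π x) ⟩
    lookup S (section (π x))              ≡⟨ constant-on-fibre x ⟩
    lookup S x                            ∎
    where
    open ≡-Reasoning
    constant-on-fibre : ∀ x → lookup S (section (π x)) ≡ lookup S x
    constant-on-fibre x with same-π⇒iterate (sym (π∘section (π x)))
    ... | i , _ , σⁱx≡ = trans (cong (lookup S) (sym σⁱx≡)) (invariant-iter S inv i x)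

  descend∘lift : ∀ S̄ → descend (lift S̄) ≡ S̄
  descend∘lift S̄ = lookup-ext λ w → trans (Vec.lookup∘tabulate _ w) (trans (lookup-lift S̄ (section w)) (cong (lookup S̄) (π∘section w)))

  lift-injective : ∀ {S̄ T̄} → lift S̄ ≡ lift T̄ → S̄ ≡ T̄
  lift-injective {S̄} {T̄} eq = trans (sym (descend∘lift S̄)) (trans (cong descend eq) (descend∘lift T̄))

  ∣lift∣ : ∀ S̄ → ∣ lift S̄ ∣ ≡ p * ∣ S̄ ∣
  ∣lift∣ S̄ = begin
    ∣ lift S̄ ∣                               ≡⟨ ∣∣≡length-elements (lift S̄) ⟩
    length (elements (lift S̄))               ≡⟨ ↭-length elements↭fibres ⟩
    length (concatMap fibre (elements S̄))    ≡⟨ length-concatMap-const fibre (elements S̄) length-fibre ⟩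
    p * length (elements S̄)                  ≡⟨ cong (p *_) (∣∣≡length-elements S̄) ⟨
    p * ∣ S̄ ∣                                ∎
    where
    open ≡-Reasoning
    elements↭fibres = unique∧same-members⇒↭ (elements-unique (lift S̄))
      (concatMap⁺ fibre π (elements-unique S̄) fibre-unique (λ _ → ∈-fibre⁻))
      (λ {x} x∈ → ∈-concatMap⁺ fibre (lose (∈-elements⁺ S̄ (trans (sym (lookup-lift S̄ x)) (∈-elements⁻ (lift S̄) x∈)))
                                            (∈-fibre⁺ refl)))
      (λ {x} x∈ → let w , w∈ , x∈fibre = find (∈-concatMap⁻ fibre x∈) in
         ∈-elements⁺ (lift S̄) (trans (lookup-lift S̄ x) (trans (cong (lookup S̄) (∈-fibre⁻ x∈fibre)) (∈-elements⁻ S̄ w∈))))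

  k≡p*k′ : k ≡ p * k′
  k≡p*k′ = begin
    k                       ≡⟨ Subset.∣⊤∣≡n k ⟨
    ∣ Subset.⊤ {k} ∣        ≡⟨ cong ∣_∣ ⊤≡lift-⊤ ⟩
    ∣ lift Subset.⊤ ∣       ≡⟨ ∣lift∣ Subset.⊤ ⟩
    p * ∣ Subset.⊤ {k′} ∣   ≡⟨ cong (p *_) (Subset.∣⊤∣≡n k′) ⟩
    p * k′                  ∎
    where
    open ≡-Reasoning
    ⊤≡lift-⊤ : Subset.⊤ ≡ lift Subset.⊤
    ⊤≡lift-⊤ = lookup-ext λ x → begin
      lookup Subset.⊤ x              ≡⟨ Vec.lookup-replicate x true ⟩
      true                           ≡⟨ Vec.lookup-replicate (π x) true ⟨
      lookup Subset.⊤ (π x)          ≡⟨ lookup-lift Subset.⊤ x ⟨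
      lookup (lift Subset.⊤) x       ∎

module QuotientGraph {p : ℕ} (pr : Prime p) (odd : p % 2 ≡ 1)
  {n m : ℕ} {G : Graph n m} {hv : Fin n → Fin n} {he : Fin m → Fin m} (aut : IsPeriodicAut p G hv he)
  {n′ m′ : ℕ} {Gb : Graph n′ m′} {πV : Fin n → Fin n′} {πE : Fin m → Fin m′} (quot : IsQuotient G hv he Gb πV πE) where

  open import Relation.Binary.PropositionalEquality
  open import Data.Nat as ℕ using (zero; suc; _+_; _∸_; _*_; _≤_; _<_; z≤n; s≤s)
  import Data.Nat.Properties as ℕ
  open import Data.Nat.DivMod using (m%n<n)
  open import Data.Nat.Divisibility using (_∣_; ∣⇒≤; m%n≡0⇒n∣m)
  open import Data.Nat.Primality using (prime⇒nonZero; euclidsLemma)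
  open import Data.Fin.Subset as Subset using (Subset; ∣_∣)
  open import Data.Fin.Subset.Properties using (⊆-antisym; ∣p∣≤n; ∣∁p∣≡n∸∣p∣)
  open import Data.Vec using (lookup; tabulate)
  import Data.Vec.Properties as Vec
  open import Data.Bool using (Bool; true; false; not; _∧_)
  open import Data.Product using (∃; _×_; _,_; proj₁; proj₂)
  open import Data.Sum using (inj₁; inj₂)
  open import Data.List using (List; []; _∷_; _++_; concatMap; length)
  open import Data.List.Properties using (length-++)
  open import Data.List.Membership.Propositional using (_∈_; find; lose)
  open import Data.List.Membership.Propositional.Properties using (∈-concatMap⁺; ∈-concatMap⁻)
  open import Data.List.Relation.Unary.Any using (here; there)
  open import Data.List.Relation.Unary.All using ([])
  import Data.List.Relation.Unary.All as All
  open import Data.List.Relation.Unary.Unique.Propositional using (Unique; []; _∷_)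
  open import Data.Empty using (⊥-elim)
  open import Function using (_∘_)
  open import Relation.Nullary using (¬_; Dec; yes; no; does)
  open import Relation.Binary.Construct.Closure.ReflexiveTransitive as Star using (ε; _◅_; _◅◅_)
  open Arithmetic using (prime>1; m*n≤m*o+1⇒n≤o)
  open Iteration using (iter-+; iter-comm)
  open Lists
  open Subsets

  open IsPeriodicAut aut
  open IsQuotient quot

  private instance _ = prime⇒nonZero pr

  module V = FreeAction hv pr orderV free πV surjV
    (λ i x → sym (proj₂ (orbitV x (iter i hv x)) (i , refl))) (λ {u} {v} → proj₁ (orbitV u v))
  module GG = Connectivity G
  module GB = Connectivity Gb

  ends-iter : ∀ i e → ends G (iter i he e) ≡ᵤ mapPair (iter i hv) (ends G e)
  ends-iter zero    e = inj₁ refl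
  ends-iter (suc i) e = ≡ᵤ-trans (incidence (iter i he e)) (≡ᵤ-mapPair hv (ends-iter i e))

  -- A power hⁱ fixing an edge must swap its ends, as it moves all vertices; then h²ⁱ fixes a vertex,
  -- although 2i ≢ 0 (mod p) because p is odd.
  freeE : ∀ e i → 1 ≤ i → i < p → iter i he e ≢ e
  freeE e i 1≤i i<p hⁱe≡e with ends G e in ends≡ | ends-iter i e
  ... | (a , b) | inj₁ ends-fixed = free a i 1≤i i<p (sym (cong proj₁ (trans (sym (trans (cong (ends G) hⁱe≡e) ends≡)) ends-fixed)))
  ... | (a , b) | inj₂ ends-swapped = free a ((i + i) ℕ.% p) 1≤2i%p (m%n<n (i + i) p) h²ⁱa≡a
    where
    swapped : (a , b) ≡ (iter i hv b , iter i hv a)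
    swapped = trans (sym (trans (cong (ends G) hⁱe≡e) ends≡)) ends-swapped
    h²ⁱa≡a : iter ((i + i) ℕ.% p) hv a ≡ a
    h²ⁱa≡a = trans (V.iter-% (i + i) a)
                   (trans (iter-+ hv i i a) (trans (cong (iter i hv) (sym (cong proj₂ swapped))) (sym (cong proj₁ swapped))))
    1≤2i%p : 1 ≤ (i + i) ℕ.% p
    1≤2i%p with (i + i) ℕ.% p in 2i%p≡
    ... | suc _ = s≤s z≤n
    ... | zero with euclidsLemma 2 i pr (subst (p ∣_) (cong (i +_) (sym (ℕ.+-identityʳ i))) (m%n≡0⇒n∣m (i + i) p 2i%p≡))
    ...   | inj₁ p∣2 = ⊥-elim (p≢2 (ℕ.≤-antisym (∣⇒≤ p∣2) (prime>1 pr)))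
      where
      p≢2 : p ≢ 2
      p≢2 p≡2 with () ← trans (sym odd) (cong (_% 2) p≡2)
    ...   | inj₂ p∣i = ⊥-elim (ℕ.<⇒≱ i<p (∣⇒≤ {n = i} {{ℕ.>-nonZero 1≤i}} p∣i))

  module E = FreeAction he pr orderE freeE πE surjE
    (λ i e → sym (proj₂ (orbitE e (iter i he e)) (i , refl))) (λ {e} {f} → proj₁ (orbitE e f))

  module _ (i : ℕ) {A A′ : Subset m} (hⁱ[A]⊆A′ : ∀ {e} → lookup A e ≡ true → lookup A′ (iter i he e) ≡ true) where

    adj-iter : ∀ {u w} → GG.Adj A u w → GG.Adj A′ (iter i hv u) (iter i hv w)
    adj-iter (GG.edge e e∈A ends≡) = GG.edge (iter i he e) (hⁱ[A]⊆A′ e∈A) (≡ᵤ-trans (ends-iter i e) (≡ᵤ-mapPair (iter i hv) ends≡))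

    reach-iter : ∀ {u w} → GG.Reach A u w → GG.Reach A′ (iter i hv u) (iter i hv w)
    reach-iter = Star.gmap (iter i hv) adj-iter

  module Lifted (B : Subset m′) where

    A : Subset m
    A = E.lift B

    reach-hⁱ : ∀ i {u w} → GG.Reach A u w → GG.Reach A (iter i hv u) (iter i hv w)
    reach-hⁱ i = reach-iter i λ {e} e∈A → trans (E.invariant-iter A (E.lift-invariant B) i e) e∈A

    reach-h : ∀ {u w} → GG.Reach A u w → GG.Reach A (hv u) (hv w)
    reach-h = reach-hⁱ 1

    reach-project : ∀ {u w} → GG.Reach A u w → GB.Reach B (πV u) (πV w)
    reach-project = Star.gmap πV λ { (GG.edge e e∈A ends≡) →
      GB.edge (πE e) (trans (sym (E.lookup-lift B e)) e∈A) (≡ᵤ-trans (endsQ e) (≡ᵤ-mapPair πV ends≡)) }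

    private
      adj-lift : ∀ {u z̄} → GB.Adj B (πV u) z̄ → ∃ λ w → πV w ≡ z̄ × GG.Adj A u w
      adj-lift {u} {z̄} (GB.edge f f∈B ends≡) with ends G (E.section f) in ends-e≡
      ... | (a , b) = lift-end (≡ᵤ-trans (≡ᵤ-sym ends-f≡) ends≡)
        where
        e = E.section f
        ends-f≡ : ends Gb f ≡ᵤ (πV a , πV b)
        ends-f≡ = subst (λ g → ends Gb g ≡ᵤ (πV a , πV b)) (E.π∘section f)
                        (subst (λ ab → ends Gb (πE e) ≡ᵤ mapPair πV ab) ends-e≡ (endsQ e))
        hʲe∈A : ∀ j → lookup A (iter j he e) ≡ true
        hʲe∈A j = trans (E.lookup-lift B _) (trans (cong (lookup B) (trans (E.π∘iter j e) (E.π∘section f))) f∈B)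
        ends-hʲe : ∀ j → ends G (iter j he e) ≡ᵤ (iter j hv a , iter j hv b)
        ends-hʲe j = subst (λ ab → ends G (iter j he e) ≡ᵤ mapPair (iter j hv) ab) ends-e≡ (ends-iter j e)
        lift-end : (πV a , πV b) ≡ᵤ (πV u , z̄) → ∃ λ w → πV w ≡ z̄ × GG.Adj A u w
        lift-end (inj₁ πa,πb≡) with V.same-π⇒iterate (cong proj₁ πa,πb≡)
        ... | j , _ , hʲa≡u = iter j hv b , trans (V.π∘iter j b) (cong proj₂ πa,πb≡) ,
              GG.edge (iter j he e) (hʲe∈A j) (subst (λ x → ends G (iter j he e) ≡ᵤ (x , iter j hv b)) hʲa≡u (ends-hʲe j))
        lift-end (inj₂ πa,πb≡) with V.same-π⇒iterate (cong proj₂ πa,πb≡)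
        ... | j , _ , hʲb≡u = iter j hv a , trans (V.π∘iter j a) (cong proj₁ πa,πb≡) ,
              GG.edge (iter j he e) (hʲe∈A j)
                (≡ᵤ-trans (subst (λ x → ends G (iter j he e) ≡ᵤ (iter j hv a , x)) hʲb≡u (ends-hʲe j)) (inj₂ refl))

    reach-lift : ∀ {u w̄} → GB.Reach B (πV u) w̄ → ∃ λ w → πV w ≡ w̄ × GG.Reach A u w
    reach-lift {u} ε = u , refl , ε
    reach-lift (ū~z̄ ◅ z̄⇝w̄) with adj-lift ū~z̄
    ... | z , refl , u~z with reach-lift z̄⇝w̄
    ...   | w , πw≡ , z⇝w = w , πw≡ , u~z ◅ z⇝w

    Stable : Fin n → Set
    Stable v = GG.Reach A v (hv v)

    stable? : ∀ v → Dec (Stable v)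
    stable? v with lookup (comp G A v) (hv v) in hv∈
    ... | true  = yes (GG.comp-sound A v hv∈)
    ... | false = no λ v⇝hv → ≡true⇒≢false (GG.comp-complete A v v⇝hv) hv∈

    stable-cong : ∀ {u w} → GG.Reach A u w → Stable u → Stable w
    stable-cong u⇝w stable = GG.reach-sym u⇝w ◅◅ stable ◅◅ reach-h u⇝w

    stable⇒reach-iter : ∀ {v} → Stable v → ∀ j → GG.Reach A v (iter j hv v)
    stable⇒reach-iter stable zero    = ε
    stable⇒reach-iter {v} stable (suc j) =
      stable⇒reach-iter stable j ◅◅ subst (GG.Reach A (iter j hv v)) (iter-comm hv j v) (reach-hⁱ j stable)

    reach-iter⇒stable : ∀ {u} d → 0 < d → d < p → GG.Reach A u (iter d hv u) → Stable u
    reach-iter⇒stable d = V.related-to-iterate⇒related-to-σ pr (GG.Reach A) ε _◅◅_ reach-h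

    stable-iter⁻ : ∀ j {u} → Stable (iter j hv u) → Stable u
    stable-iter⁻ zero    stable = stable
    stable-iter⁻ (suc j) {u} stable = stable-iter⁻ j (subst₂ (GG.Reach A) (V.σ⁻¹∘σ x) (V.σ⁻¹∘σ (hv x)) (reach-hⁱ (p ℕ.∸ 1) stable))
      where x = iter j hv u

    -- Distinct vertices of an unstable component lie in distinct h-orbits: if hʲx lay in the
    -- component of x for some 0 < j < p, the component would be stable.
    unstable⇒πV-injective : ∀ {v x y} → ¬ Stable v → GG.Reach A v x → GG.Reach A v y → πV x ≡ πV y → x ≡ y
    unstable⇒πV-injective {v} {x} ¬stable v⇝x v⇝y πx≡πy with V.same-π⇒iterate πx≡πy
    ... | zero  , _   , x≡y  = x≡y
    ... | suc j , j<p , hʲx≡y = ⊥-elim (¬stable (stable-cong (GG.reach-sym v⇝x)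
            (reach-iter⇒stable (suc j) (s≤s z≤n) j<p (subst (GG.Reach A x) (sym hʲx≡y) (GG.reach-sym v⇝x ◅◅ v⇝y)))))

    comp-stable : ∀ {v} → Stable v → comp G A v ≡ V.lift (comp Gb B (πV v))
    comp-stable {v} stable = ⊆-antisym (lookup-⊆ into) (lookup-⊆ from)
      where
      into : ∀ {w} → lookup (comp G A v) w ≡ true → lookup (V.lift (comp Gb B (πV v))) w ≡ true
      into {w} w∈ = trans (V.lookup-lift (comp Gb B (πV v)) w) (GB.comp-complete B (πV v) (reach-project (GG.comp-sound A v w∈)))
      from : ∀ {w} → lookup (V.lift (comp Gb B (πV v))) w ≡ true → lookup (comp G A v) w ≡ true
      from {w} w∈ with reach-lift (GB.comp-sound B (πV v) (trans (sym (V.lookup-lift (comp Gb B (πV v)) w)) w∈))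
      ... | w′ , πw′≡πw , v⇝w′ with V.same-π⇒iterate πw′≡πw
      ...   | j , _ , hʲw′≡w = GG.comp-complete A v
              (stable⇒reach-iter stable j ◅◅ subst (GG.Reach A (iter j hv v)) hʲw′≡w (reach-hⁱ j v⇝w′))

    ∣comp∣-stable : ∀ {v} → Stable v → ∣ comp G A v ∣ ≡ p * ∣ comp Gb B (πV v) ∣
    ∣comp∣-stable {v} stable = trans (cong ∣_∣ (comp-stable stable)) (V.∣lift∣ (comp Gb B (πV v)))

    ∣comp∣-unstable : ∀ {v} → ¬ Stable v → ∣ comp G A v ∣ ≡ ∣ comp Gb B (πV v) ∣
    ∣comp∣-unstable {v} ¬stable = ∣∣-bijection (comp G A v) (comp Gb B (πV v)) πV
      (λ x∈ y∈ → unstable⇒πV-injective ¬stable (GG.comp-sound A v x∈) (GG.comp-sound A v y∈))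
      (λ x∈ → GB.comp-complete B (πV v) (reach-project (GG.comp-sound A v x∈)))
      (λ ȳ∈ → let y , πy≡ , v⇝y = reach-lift (GB.comp-sound B (πV v) ȳ∈) in y , GG.comp-complete A v v⇝y , πy≡)

    -- Over a component of Gb|B lie either one stable component of G|A or p unstable ones,
    -- and the latter meet the fibre of any vertex of Gb once each.
    private
      above′ : ∀ w̄ → Dec (Stable (V.section w̄)) → List (Fin n)
      above′ w̄ (yes _) = V.section w̄ ∷ []
      above′ w̄ (no  _) = V.fibre w̄

    above : Fin n′ → List (Fin n)
    above w̄ = above′ w̄ (stable? (V.section w̄))

    private
      ∈-above⁻ : ∀ w̄ {x} → x ∈ above w̄ → πV x ≡ w̄
      ∈-above⁻ w̄ x∈ with stable? (V.section w̄)
      ∈-above⁻ w̄ (here refl) | yes _ = V.π∘section w̄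
      ... | no _ = V.∈-fibre⁻ x∈

      above-unique : ∀ w̄ → Unique (above w̄)
      above-unique w̄ with stable? (V.section w̄)
      ... | yes _ = [] ∷ []
      ... | no  _ = V.fibre-unique w̄

      above-separated : ∀ w̄ {x y} → x ∈ above w̄ → y ∈ above w̄ → GG.Reach A x y → x ≡ y
      above-separated w̄ x∈ y∈ x⇝y with stable? (V.section w̄)
      above-separated w̄ (here refl) (here refl) x⇝y | yes _ = refl
      above-separated w̄ x∈ y∈ x⇝y | no ¬stable with V.∈-orbit⁻ (V.section w̄) x∈
      ... | i , _ , refl = unstable⇒πV-injective (¬stable ∘ stable-iter⁻ i) ε x⇝y
                             (trans (V.∈-fibre⁻ x∈) (sym (V.∈-fibre⁻ y∈)))

    transversal : GG.Transversal A (concatMap above (GB.reps B))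
    transversal = record
      { unique    = concatMap⁺ above πV (GB.reps-unique B) above-unique ∈-above⁻
      ; separated = separated
      ; covering  = covering
      }
      where
      separated : ∀ {x y} → x ∈ concatMap above (GB.reps B) → y ∈ concatMap above (GB.reps B) → GG.Reach A x y → x ≡ y
      separated x∈ y∈ x⇝y with find (∈-concatMap⁻ above x∈) | find (∈-concatMap⁻ above y∈)
      ... | w̄₁ , w̄₁∈ , x∈₁ | w̄₂ , w̄₂∈ , y∈₂
          with GB.rep-unique (GB.∈-reps⁻ w̄₁∈) (GB.∈-reps⁻ w̄₂∈)
                 (subst₂ (GB.Reach B) (∈-above⁻ w̄₁ x∈₁) (∈-above⁻ w̄₂ y∈₂) (reach-project x⇝y))
      ...   | refl = above-separated w̄₁ x∈₁ y∈₂ x⇝y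
      covering : ∀ v → ∃ λ x → x ∈ concatMap above (GB.reps B) × GG.Reach A v x
      covering v with reach-lift (GB.reach-repOf B (πV v))
      ... | w , πw≡r̄ , v⇝w = x , ∈-concatMap⁺ above (lose r̄∈ x∈) , v⇝x
        where
        r̄ = GB.repOf B (πV v)
        r̄∈ : r̄ ∈ GB.reps B
        r̄∈ = GB.∈-reps⁺ (GB.repOf-isRep B (πV v))
        pick : (d : Dec (Stable (V.section r̄))) → ∃ λ x → x ∈ above′ r̄ d × GG.Reach A v x
        pick (yes stable) with V.same-π⇒iterate (trans (V.π∘section r̄) (sym πw≡r̄))
        ... | j , _ , hʲs≡w = V.section r̄ , here refl ,
                (v⇝w ◅◅ GG.reach-sym (subst (GG.Reach A (V.section r̄)) hʲs≡w (stable⇒reach-iter stable j)))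
        pick (no _) = w , V.∈-fibre⁺ πw≡r̄ , v⇝w
        x = proj₁ (pick (stable? (V.section r̄)))
        x∈ = proj₁ (proj₂ (pick (stable? (V.section r̄))))
        v⇝x = proj₂ (proj₂ (pick (stable? (V.section r̄))))

    stableᵇ : Fin n′ → Bool
    stableᵇ w̄ = does (stable? (V.section w̄))

    #stable #unstable : ℕ
    #stable   = countL stableᵇ (GB.reps B)
    #unstable = countL (not ∘ stableᵇ) (GB.reps B)

    private
      length-above : ∀ w̄s → length (concatMap above w̄s) ≡ countL stableᵇ w̄s + p * countL (not ∘ stableᵇ) w̄s
      length-above []         = sym (ℕ.*-zeroʳ p)
      length-above (w̄ ∷ w̄s) with stable? (V.section w̄)
      ... | yes _ = cong suc (length-above w̄s)
      ... | no  _ = begin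
        length (V.fibre w̄ ++ concatMap above w̄s)    ≡⟨ length-++ (V.fibre w̄) ⟩
        length (V.fibre w̄) + length (concatMap above w̄s)  ≡⟨ cong₂ _+_ (V.length-fibre w̄) (length-above w̄s) ⟩
        p + (s + p * t)                              ≡⟨ ℕ.+-assoc p s (p * t) ⟨
        (p + s) + p * t                              ≡⟨ cong (_+ p * t) (ℕ.+-comm p s) ⟩
        (s + p) + p * t                              ≡⟨ ℕ.+-assoc s p (p * t) ⟩
        s + (p + p * t)                              ≡⟨ cong (s +_) (ℕ.*-suc p t) ⟨
        s + p * suc t                                ∎
        where
        open ≡-Reasoning
        s = countL stableᵇ w̄s
        t = countL (not ∘ stableᵇ) w̄s

    numComp-lift : numComp G A ≡ #stable + p * #unstable
    numComp-lift = trans (GG.numComp≡length transversal) (length-above (GB.reps B))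

    numComp-quotient : numComp Gb B ≡ #stable + #unstable
    numComp-quotient = trans (GB.numComp≡length-reps B) (sym (countL+countL-not≡length stableᵇ (GB.reps B)))

    -- A stable component C contains a cycle: the edges of A inside C form an h-invariant set,
    -- so their number is a multiple p·b of p, while spanning C, of size p·c, needs at least p·c − 1 of them;
    -- hence b ≥ c and the spanning subgraph on these edges has positive nullity.
    module _ {v₀} (stable : Stable v₀) where

      private
        C : Subset n
        C = comp G A v₀

        C-invariant : V.Invariant C
        C-invariant = subst V.Invariant (sym (comp-stable stable)) (V.lift-invariant (comp Gb B (πV v₀)))

        A-edge-in-C : ∀ e → lookup A e ≡ true → lookup C (proj₁ (ends G e)) ≡ lookup C (proj₂ (ends G e))
        A-edge-in-C e e∈A = true⇔true⇒≡
          (λ a∈C → GG.comp-complete A v₀ (GG.comp-sound A v₀ a∈C ◅◅ GG.reach-adj (GG.edge e e∈A (inj₁ refl))))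
          (λ b∈C → GG.comp-complete A v₀ (GG.comp-sound A v₀ b∈C ◅◅ GG.reach-adj (GG.edge e e∈A (inj₂ refl))))

        A′ : Subset m
        A′ = tabulate λ e → lookup A e ∧ lookup C (proj₁ (ends G e))

        lookup-A′ : ∀ e → lookup A′ e ≡ (lookup A e ∧ lookup C (proj₁ (ends G e)))
        lookup-A′ e = Vec.lookup∘tabulate _ e

        A′⊆A : A′ Subset.⊆ A
        A′⊆A = lookup-⊆ λ {e} e∈A′ → proj₁ (∧≡true (trans (sym (lookup-A′ e)) e∈A′))

        A′-invariant : E.Invariant A′
        A′-invariant e = trans (lookup-A′ (he e)) (trans (go (lookup A e) refl) (sym (lookup-A′ e)))
          where
          A-inv = E.lift-invariant B e
          go : ∀ b → lookup A e ≡ b → (lookup A (he e) ∧ lookup C (proj₁ (ends G (he e)))) ≡ (b ∧ lookup C (proj₁ (ends G e)))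
          go false e∉A = cong (_∧ lookup C (proj₁ (ends G (he e)))) (trans A-inv e∉A)
          go true  e∈A with incidence e
          ... | inj₁ ends≡ = cong₂ _∧_ (trans A-inv e∈A) (trans (cong (lookup C ∘ proj₁) ends≡) (C-invariant _))
          ... | inj₂ ends≡ = cong₂ _∧_ (trans A-inv e∈A)
                               (trans (cong (lookup C ∘ proj₁) ends≡) (trans (C-invariant _) (sym (A-edge-in-C e e∈A))))

        adj-A′⇒∈C : ∀ {u w} → GG.Adj A′ u w → lookup C u ≡ true × lookup C w ≡ true
        adj-A′⇒∈C (GG.edge e e∈A′ ends≡) with ∧≡true {lookup A e} (trans (sym (lookup-A′ e)) e∈A′)
        ... | e∈A , fst∈C with ends≡
        ... | inj₁ refl = fst∈C , trans (sym (A-edge-in-C e e∈A)) fst∈C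
        ... | inj₂ refl = trans (sym (A-edge-in-C e e∈A)) fst∈C , fst∈C

        reach-A′-outside : ∀ {u w} → lookup C u ≡ false → GG.Reach A′ u w → u ≡ w
        reach-A′-outside u∉C ε             = refl
        reach-A′-outside u∉C (u~z ◅ _) = ⊥-elim (≡true⇒≢false (proj₁ (adj-A′⇒∈C u~z)) u∉C)

        reach-A⇒reach-A′ : ∀ {u w} → lookup C u ≡ true → GG.Reach A u w → GG.Reach A′ u w
        reach-A⇒reach-A′ u∈C ε = ε
        reach-A⇒reach-A′ {u} u∈C (GG.edge e e∈A ends≡ ◅ z⇝w) = GG.edge e e∈A′ ends≡ ◅ reach-A⇒reach-A′ z∈C z⇝w
          where
          z∈C = GG.comp-complete A v₀ (GG.comp-sound A v₀ u∈C ◅◅ GG.reach-adj (GG.edge e e∈A ends≡))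
          fst∈C : ends G e ≡ᵤ (u , _) → lookup C (proj₁ (ends G e)) ≡ true
          fst∈C (inj₁ ends≡) = subst (λ x → lookup C x ≡ true) (sym (cong proj₁ ends≡)) u∈C
          fst∈C (inj₂ ends≡) = subst (λ x → lookup C x ≡ true) (sym (cong proj₁ ends≡)) z∈C
          e∈A′ = trans (lookup-A′ e) (cong₂ _∧_ e∈A (fst∈C ends≡))

        lookup-∁C : ∀ x → lookup (Subset.∁ C) x ≡ not (lookup C x)
        lookup-∁C x = Vec.lookup-map x not C

        ∈∁C⁻ : ∀ {x} → x ∈ elements (Subset.∁ C) → lookup C x ≡ false
        ∈∁C⁻ {x} x∈ with lookup C x | trans (sym (lookup-∁C x)) (∈-elements⁻ (Subset.∁ C) x∈)
        ... | false | _ = refl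

        transversal-A′ : GG.Transversal A′ (v₀ ∷ elements (Subset.∁ C))
        transversal-A′ = record
          { unique    = All.tabulate (λ y∈ v₀≡y → ≡true⇒≢false (subst (λ y → lookup C y ≡ true) v₀≡y v₀∈C) (∈∁C⁻ y∈))
                        ∷ elements-unique (Subset.∁ C)
          ; separated = separated
          ; covering  = covering
          }
          where
          v₀∈C = GG.comp-complete A v₀ ε
          separated : ∀ {x y} → x ∈ v₀ ∷ elements (Subset.∁ C) → y ∈ v₀ ∷ elements (Subset.∁ C) → GG.Reach A′ x y → x ≡ y
          separated (here refl) (here refl) _   = refl
          separated (here refl) (there y∈)  x⇝y = sym (reach-A′-outside (∈∁C⁻ y∈) (GG.reach-sym x⇝y))
          separated (there x∈)  _           x⇝y = reach-A′-outside (∈∁C⁻ x∈) x⇝y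
          covering : ∀ v → ∃ λ x → x ∈ v₀ ∷ elements (Subset.∁ C) × GG.Reach A′ v x
          covering v with lookup C v in v∈C
          ... | true  = v₀ , here refl , reach-A⇒reach-A′ v∈C (GG.reach-sym (GG.comp-sound A v₀ v∈C))
          ... | false = v , there (∈-elements⁺ (Subset.∁ C) (trans (lookup-∁C v) (cong not v∈C))) , ε

        numComp-A′ : numComp G A′ ≡ suc (n ∸ ∣ C ∣)
        numComp-A′ = trans (GG.numComp≡length transversal-A′)
                           (cong suc (trans (sym (∣∣≡length-elements (Subset.∁ C))) (∣∁p∣≡n∸∣p∣ C)))

      stable⇒nullity-positive : suc n ≤ ∣ A ∣ + numComp G A
      stable⇒nullity-positive = ℕ.≤-trans A′-bound (GG.nullity-mono A′⊆A)
        where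
        c  = ∣ comp Gb B (πV v₀) ∣
        b′ = ∣ E.descend A′ ∣
        r  = n ∸ ∣ C ∣
        ∣A′∣≡ : ∣ A′ ∣ ≡ p * b′
        ∣A′∣≡ = trans (cong ∣_∣ (sym (E.invariant⇒lift∘descend A′ A′-invariant))) (E.∣lift∣ (E.descend A′))
        n≡ : n ≡ r + p * c
        n≡ = trans (sym (ℕ.m∸n+n≡m (∣p∣≤n C))) (cong (r +_) (∣comp∣-stable stable))
        size≡ : ∣ A′ ∣ + numComp G A′ ≡ r + (p * b′ + 1)
        size≡ = trans (cong₂ _+_ ∣A′∣≡ numComp-A′) (rearrange (p * b′) r)
          where
          rearrange : ∀ x r → x + suc r ≡ r + (x + 1)
          rearrange x r = trans (ℕ.+-suc x r) (trans (cong suc (ℕ.+-comm x r)) (trans (sym (ℕ.+-suc r x)) (cong (r +_) (ℕ.+-comm 1 x))))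
        pc≤pb′+1 : p * c ≤ p * b′ + 1
        pc≤pb′+1 = ℕ.+-cancelˡ-≤ r _ _ (subst₂ _≤_ n≡ size≡ (GG.rank≤ A′))
        A′-bound : suc n ≤ ∣ A′ ∣ + numComp G A′
        A′-bound = subst₂ _≤_ (cong suc (sym n≡)) (sym size≡)
          (subst (_≤ r + (p * b′ + 1)) (ℕ.+-suc r (p * c)) (ℕ.+-monoʳ-≤ r (subst (suc (p * c) ≤_) (ℕ.+-comm 1 (p * b′))
            (s≤s (ℕ.*-monoʳ-≤ p (m*n≤m*o+1⇒n≤o (prime>1 pr) pc≤pb′+1))))))

module Comparison {p : ℕ} (pr : Prime p) (odd : p % 2 ≡ 1)
  {n m : ℕ} {G : Graph n m} {hv : Fin n → Fin n} {he : Fin m → Fin m} (aut : IsPeriodicAut p G hv he)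
  {n′ m′ : ℕ} {Gb : Graph n′ m′} {πV : Fin n → Fin n′} {πE : Fin m → Fin m′} (quot : IsQuotient G hv he Gb πV πE) where

  open import Relation.Binary.PropositionalEquality
  open import Data.Nat as ℕ using (zero; suc; _+_; _∸_; _*_; _≤_; _<_)
  import Data.Nat.Properties as ℕ
  open import Data.Nat.Primality using (prime⇒nonZero)
  open import Data.Bool as Bool using ()
  open import Data.Fin.Subset using (Subset; ∣_∣)
  import Data.Fin.Subset.Properties as Subset
  open import Data.Vec using (lookup; tabulate)
  import Data.Vec.Properties as Vec
  open import Data.List using (List; map; filter; concatMap; length)
  open import Data.List.Properties using (map-∘; map-cong; length-map)
  open import Data.List.Membership.Propositional using (_∈_)
  open import Data.List.Membership.Propositional.Properties using (∈-map⁺; ∈-map⁻; ∈-filter⁺; ∈-filter⁻)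
  import Data.List.Relation.Unary.Unique.Propositional.Properties as Unique
  open import Data.List.Relation.Binary.Permutation.Propositional using (_↭_)
  import Data.List.Relation.Binary.Permutation.Propositional.Properties as Perm
  open import Data.Product using (_,_; proj₂)
  open import Function using (_∘_)
  open import Relation.Nullary using (yes; no)
  open Arithmetic using (∸-+-*-shift)
  open Iteration using (iter-comm)
  open Lists
  open Subsets
  open QuotientRing p n

  module _ {k l} (H : Graph k l) where
    open Connectivity H

    component-product : Subset l → List (Fin k) → Expr n
    component-product A vs = prodE (map (λ v → xv n ∣ comp H A v ∣) vs)

    component-product-transversal : ∀ {A L} → Transversal A L → component-product A (reps A) ≈ component-product A L
    component-product-transversal {A} {L} T = begin
      prodE (map F (reps A))              ≈⟨ prodE-↭ (Perm.map⁺ F (map-repOf↭reps T)) ⟨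
      prodE (map F (map (repOf A) L))     ≡⟨ cong prodE (sym (map-∘ L)) ⟩
      prodE (map (F ∘ repOf A) L)         ≡⟨ cong prodE (map-cong (λ x → cong (xv n ∘ ∣_∣) (sym (comp-cong A (reach-repOf A x)))) L) ⟩
      prodE (map F L)                     ∎
      where
      open ≈-Reasoning
      F = λ v → xv n ∣ comp H A v ∣

  summand : ∀ {k l} (H : Graph k l) → Subset l → Expr n
  summand {k} H A = component-product H A (Connectivity.reps H A) ⊗ pow (yv ⊝ 1e) ((∣ A ∣ + numComp H A) ∸ k)

  private instance _ = prime⇒nonZero pr
  open IsPeriodicAut aut
  module Q = QuotientGraph pr odd aut quot
  module V = Q.V
  module E = Q.E
  module GG = Connectivity G
  module GB = Connectivity Gb

  σE : Subset m → Subset m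
  σE A = tabulate (lookup A ∘ he)

  module _ (A : Subset m) where

    private
      lookup-σE : ∀ e → lookup (σE A) e ≡ lookup A (he e)
      lookup-σE e = Vec.lookup∘tabulate _ e

      ∣σE∣ : ∣ σE A ∣ ≡ ∣ A ∣
      ∣σE∣ = ∣∣-bijection (σE A) A he (λ _ _ → E.σ-injective) (λ {e} e∈ → trans (sym (lookup-σE e)) e∈)
        λ {e} e∈A → E.σ⁻¹ e , trans (lookup-σE _) (trans (cong (lookup A) (E.σ∘σ⁻¹ e)) e∈A) , E.σ∘σ⁻¹ e

      reach-σE⇒reach : ∀ {u w} → GG.Reach (σE A) u w → GG.Reach A (hv u) (hv w)
      reach-σE⇒reach = Q.reach-iter 1 λ {e} e∈ → trans (sym (lookup-σE e)) e∈

      reach⇒reach-σE : ∀ {u w} → GG.Reach A u w → GG.Reach (σE A) (V.σ⁻¹ u) (V.σ⁻¹ w)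
      reach⇒reach-σE = Q.reach-iter (p ∸ 1) λ {e} e∈A → trans (lookup-σE _) (trans (cong (lookup A) (E.σ∘σ⁻¹ e)) e∈A)

      reach-hv⇒reach-σE : ∀ {u w} → GG.Reach A (hv u) (hv w) → GG.Reach (σE A) u w
      reach-hv⇒reach-σE {u} {w} hu⇝hw = subst₂ (GG.Reach (σE A)) (V.σ⁻¹∘σ u) (V.σ⁻¹∘σ w) (reach⇒reach-σE hu⇝hw)

      ∣comp-σE∣ : ∀ u → ∣ comp G (σE A) u ∣ ≡ ∣ comp G A (hv u) ∣
      ∣comp-σE∣ u = ∣∣-bijection (comp G (σE A) u) (comp G A (hv u)) hv (λ _ _ → V.σ-injective)
        (λ x∈ → GG.comp-complete A (hv u) (reach-σE⇒reach (GG.comp-sound (σE A) u x∈)))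
        λ {y} y∈ → V.σ⁻¹ y ,
          GG.comp-complete (σE A) u (reach-hv⇒reach-σE (subst (GG.Reach A (hv u)) (sym (V.σ∘σ⁻¹ y)) (GG.comp-sound A (hv u) y∈))) ,
          V.σ∘σ⁻¹ y

      transversal-σE : GG.Transversal (σE A) (map V.σ⁻¹ (GG.reps A))
      transversal-σE = record
        { unique    = Unique.map⁺ (V.iter-injective (p ∸ 1)) (GG.reps-unique A)
        ; separated = separated
        ; covering  = λ v → V.σ⁻¹ (GG.repOf A (hv v)) , ∈-map⁺ V.σ⁻¹ (GG.∈-reps⁺ (GG.repOf-isRep A (hv v))) ,
                            reach-hv⇒reach-σE (subst (GG.Reach A (hv v)) (sym (V.σ∘σ⁻¹ _)) (GG.reach-repOf A (hv v)))
        }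
        where
        separated : ∀ {x y} → x ∈ map V.σ⁻¹ (GG.reps A) → y ∈ map V.σ⁻¹ (GG.reps A) → GG.Reach (σE A) x y → x ≡ y
        separated x∈ y∈ x⇝y with ∈-map⁻ V.σ⁻¹ x∈ | ∈-map⁻ V.σ⁻¹ y∈
        ... | r , r∈ , refl | s , s∈ , refl = cong V.σ⁻¹ (GG.rep-unique (GG.∈-reps⁻ r∈) (GG.∈-reps⁻ s∈)
                (subst₂ (GG.Reach A) (V.σ∘σ⁻¹ r) (V.σ∘σ⁻¹ s) (reach-σE⇒reach x⇝y)))

    summand-σE : summand G (σE A) ≈ summand G A
    summand-σE = ⊗-cong product (reflexive (cong (λ k → pow (yv ⊝ 1e) (k ∸ n)) (cong₂ _+_ ∣σE∣ numComp≡)))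
      where
      numComp≡ : numComp G (σE A) ≡ numComp G A
      numComp≡ = trans (GG.numComp≡length transversal-σE)
                       (trans (length-map V.σ⁻¹ (GG.reps A)) (sym (GG.numComp≡length-reps A)))
      product : component-product G (σE A) (GG.reps (σE A)) ≈ component-product G A (GG.reps A)
      product = ≈trans (component-product-transversal G transversal-σE) (reflexive (cong prodE (begin
        map (λ v → xv n ∣ comp G (σE A) v ∣) (map V.σ⁻¹ (GG.reps A))   ≡⟨ map-∘ (GG.reps A) ⟨
        map (λ r → xv n ∣ comp G (σE A) (V.σ⁻¹ r) ∣) (GG.reps A)       ≡⟨ map-cong (λ r → cong (xv n) (trans (∣comp-σE∣ (V.σ⁻¹ r)) (cong (λ v → ∣ comp G A v ∣) (V.σ∘σ⁻¹ r)))) (GG.reps A) ⟩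
        map (λ r → xv n ∣ comp G A r ∣) (GG.reps A)                   ∎)))
        where open ≡-Reasoning

  σE^p≡id : ∀ A → iter p σE A ≡ A
  σE^p≡id A = lookup-ext λ e → trans (lookup-iter p A e) (cong (lookup A) (orderE e))
    where
    lookup-iter : ∀ k A e → lookup (iter k σE A) e ≡ lookup A (iter k he e)
    lookup-iter zero    A e = refl
    lookup-iter (suc k) A e = trans (Vec.lookup∘tabulate _ e)
                                    (trans (lookup-iter k A (he e)) (cong (lookup A) (iter-comm he k e)))

  module O = OrbitSum (Vec.≡-dec Bool._≟_) σE pr σE^p≡id n

  fixed↭lifts : filter O.fixed? (subsets m) ↭ map E.lift (subsets m′)
  fixed↭lifts = unique∧same-members⇒↭ (Unique.filter⁺ O.fixed? (subsets-unique m))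
    (map⁺-injectiveOn E.lift (subsets-unique m′) (λ _ _ → E.lift-injective)) to from
    where
    to : ∀ {A} → A ∈ filter O.fixed? (subsets m) → A ∈ map E.lift (subsets m′)
    to {A} A∈ = subst (_∈ map E.lift (subsets m′)) (E.invariant⇒lift∘descend A invariant) (∈-map⁺ E.lift (∈-subsets (E.descend A)))
      where
      invariant : E.Invariant A
      invariant e = trans (sym (Vec.lookup∘tabulate _ e)) (cong (λ S → lookup S e) (proj₂ (∈-filter⁻ O.fixed? {xs = subsets m} A∈)))
    from : ∀ {A} → A ∈ map E.lift (subsets m′) → A ∈ filter O.fixed? (subsets m)
    from A∈ with ∈-map⁻ E.lift A∈
    ... | B , _ , refl = ∈-filter⁺ O.fixed? (∈-subsets (E.lift B)) (lookup-ext λ e → trans (Vec.lookup∘tabulate _ e) (E.lift-invariant B e))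

  module _ (B : Subset m′) where
    open Q.Lifted B

    product-above : ∀ w̄ → component-product G A (above w̄) ≈ xv n ∣ comp Gb B w̄ ∣
    product-above w̄ with stable? (V.section w̄)
    ... | yes stable = ≈trans ⊗-idʳ (≈trans (reflexive (cong (xv n) ∣C∣≡pc))
                         (xv[p*c]≈xv[c] pr c (GB.1≤∣comp∣ B w̄) (subst (_≤ n) ∣C∣≡pc (Subset.∣p∣≤n (comp G A (V.section w̄))))))
      where
      c = ∣ comp Gb B w̄ ∣
      ∣C∣≡pc : ∣ comp G A (V.section w̄) ∣ ≡ p * c
      ∣C∣≡pc = trans (∣comp∣-stable stable) (cong (λ v → p * ∣ comp Gb B v ∣) (V.π∘section w̄))
    ... | no ¬stable = begin
      prodE (map (λ v → xv n ∣ comp G A v ∣) (V.fibre w̄))   ≈⟨ prodE-map-const (V.fibre w̄) each ⟩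
      xv n ∣ comp Gb B w̄ ∣ ^ length (V.fibre w̄)          ≡⟨ cong (xv n ∣ comp Gb B w̄ ∣ ^_) (V.length-fibre w̄) ⟩
      xv n ∣ comp Gb B w̄ ∣ ^ p                          ≈⟨ xv^p≈xv pr ∣ comp Gb B w̄ ∣ ⟩
      xv n ∣ comp Gb B w̄ ∣                              ∎
      where
      open ≈-Reasoning
      each : ∀ {v} → v ∈ V.fibre w̄ → xv n ∣ comp G A v ∣ ≈ xv n ∣ comp Gb B w̄ ∣
      each {v} v∈ with V.∈-orbit⁻ (V.section w̄) v∈
      ... | i , _ , refl = reflexive (cong (xv n) (trans (∣comp∣-unstable (¬stable ∘ stable-iter⁻ i))
                                                        (cong (λ u → ∣ comp Gb B u ∣) (V.∈-fibre⁻ v∈))))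

    lifted-product : component-product G A (GG.reps A) ≈ component-product Gb B (GB.reps B)
    lifted-product = begin
      component-product G A (GG.reps A)                                    ≈⟨ component-product-transversal G transversal ⟩
      component-product G A (concatMap above (GB.reps B))                  ≈⟨ prodE-concatMap _ above (GB.reps B) ⟩
      prodE (map (λ w̄ → component-product G A (above w̄)) (GB.reps B))     ≈⟨ prodE-map-cong (GB.reps B) (λ {w̄} _ → product-above w̄) ⟩
      component-product Gb B (GB.reps B)                                   ∎
      where open ≈-Reasoning

    private
      b s t : ℕ
      b = ∣ B ∣
      s = #stable
      t = #unstable

      some-stable⇒nullity-positive : 1 ≤ s → 1 ≤ (∣ A ∣ + numComp G A) ∸ n
      some-stable⇒nullity-positive 1≤s with countL≢0⇒∃ stableᵇ (GB.reps B) 1≤s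
      ... | w̄ , _ , stableᵇ≡true with stable? (V.section w̄)
      ...   | yes stable = ℕ.m<n⇒0<n∸m (stable⇒nullity-positive stable)

      exponents : (∣ A ∣ + numComp G A) ∸ n + (p ∸ 1) * s ≡ p * ((∣ B ∣ + numComp Gb B) ∸ n′)
      exponents = begin
        (∣ A ∣ + numComp G A) ∸ n + (p ∸ 1) * s           ≡⟨ cong (λ e → e + (p ∸ 1) * s) (cong₂ _∸_ sizeA V.k≡p*k′) ⟩
        (p * b + (s + p * t)) ∸ p * n′ + (p ∸ 1) * s      ≡⟨ ∸-+-*-shift p b s t n′ rank-B rank-A ⟩
        p * ((b + (s + t)) ∸ n′)                          ≡⟨ cong (λ k → p * ((b + k) ∸ n′)) numComp-quotient ⟨
        p * ((∣ B ∣ + numComp Gb B) ∸ n′)                 ∎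
        where
        open ≡-Reasoning
        sizeA : ∣ A ∣ + numComp G A ≡ p * b + (s + p * t)
        sizeA = cong₂ _+_ (E.∣lift∣ B) numComp-lift
        rank-B : n′ ≤ b + (s + t)
        rank-B = subst (n′ ≤_) (cong (b +_) numComp-quotient) (GB.rank≤ B)
        rank-A : p * n′ ≤ p * b + (s + p * t)
        rank-A = subst₂ _≤_ V.k≡p*k′ sizeA (GG.rank≤ A)

    lifted-summand : summand G A ≈ summand Gb B
    lifted-summand = ⊗-cong lifted-product (begin
      pow (yv ⊝ 1e) eA   ≡⟨ pow≡^ _ eA ⟩
      (yv ⊝ 1e) ^ eA     ≈⟨ ^-exponent-shift pr ([y-1]^p≈y-1 pr odd) eA eB s exponents some-stable⇒nullity-positive ⟩
      (yv ⊝ 1e) ^ eB     ≡⟨ pow≡^ _ eB ⟨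
      pow (yv ⊝ 1e) eB   ∎)
      where
      open ≈-Reasoning
      eA = (∣ A ∣ + numComp G A) ∸ n
      eB = (∣ B ∣ + numComp Gb B) ∸ n′

  U≈U : U n G ≈ U n Gb
  U≈U = begin
    sumE (map (summand G) (subsets m))                       ≈⟨ O.sumE≈sumE-fixed (summand G) summand-σE _ (subsets m) ℕ.≤-refl
                                                                  (subsets-unique m) (λ {A} _ → ∈-subsets (σE A)) ⟩
    sumE (map (summand G) (filter O.fixed? (subsets m)))     ≈⟨ sumE-↭ (Perm.map⁺ (summand G) fixed↭lifts) ⟩
    sumE (map (summand G) (map E.lift (subsets m′)))         ≡⟨ cong sumE (map-∘ (subsets m′)) ⟨
    sumE (map (summand G ∘ E.lift) (subsets m′))             ≈⟨ sumE-map-cong (subsets m′) (λ {B} _ → lifted-summand B) ⟩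
    sumE (map (summand Gb) (subsets m′))                     ∎
    where open ≈-Reasoning

theorem3p1 : (p : ℕ) → Prime p → p % 2 ≡ 1 →
    {n m : ℕ} (G : Graph n m) (hv : Fin n → Fin n) (he : Fin m → Fin m) →
    IsPeriodicAut p G hv he →
    {n' m' : ℕ} (Gb : Graph n' m') (πV : Fin n → Fin n') (πE : Fin m → Fin m') →
    IsQuotient G hv he Gb πV πE →
    U n G ≈[ p ] U n Gb
theorem3p1 p pr odd G hv he aut Gb πV πE quot = Comparison.U≈U pr odd aut quot
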